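{- Let $p$ be a prime and $n\ge 1$. The group $G=(\mathbb{Z}_{p^n})^{\omega}$, the direct sum of countably infinitely many copies of $\mathbb{Z}_{p^n}$, has Scott complexity $\Pi_2$.
   Context: A Scott sentence for a countable structure is a sentence of $L_{\omega_1\omega}$ whose countable models are exactly the structures isomorphic to it. The Scott complexity of a countable structure is the least complexity among $\Pi_\alpha$, $\Sigma_\alpha$, $d$-$\Sigma_\alpha$ (in the standard hierarchy of infinitary $L_{\omega_1\omega}$ formulas) of a Scott sentence for it, where a formula is $d$-$\Sigma_\alpha$ if it is the conjunction of a $\Sigma_\alpha$ and a $\Pi_\alpha$ formula. Groups are structures in the language of groups. -}

module Defs where

open import Data.Nat using (ℕ; zero; suc; _+_; _∸_; _^_; _%_; NonZero)
open import Data.Nat.Properties using (+-identityʳ; m^n≢0)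
open import Data.Nat.DivMod using (%-distribˡ-+; n%n≡0)
open import Data.Nat.Primality using (Prime)
open import Data.Fin using (Fin)
open import Data.List using (List; []; _∷_; map)
open import Data.Product using (Σ; ∃; _×_; _,_; proj₁; proj₂)
open import Data.Sum using (_⊎_)
open import Data.Empty using (⊥)
open import Data.Vec.Functional using (Vector; _++_)
open import Relation.Nullary using (¬_)
open import Relation.Binary using (IsEquivalence)
open import Relation.Binary.PropositionalEquality
  using (_≡_; refl; sym; trans; cong; cong₂)
open import Function.Bundles using (_⇔_)

-- Structures in the language of groups {·, ⁻¹, e}.
-- Equality of the structure is a congruence _≈_ (setoid presentation);
-- atomic formulas t₁ = t₂ are interpreted by _≈_.

record Str : Set₁ where
  field
    Carrier : Set
    _≈_     : Carrier → Carrier → Set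
    isEquiv : IsEquivalence _≈_
    _∙_     : Carrier → Carrier → Carrier
    _⁻¹     : Carrier → Carrier
    ε       : Carrier
    ∙-cong  : ∀ {x x′ y y′} → x ≈ x′ → y ≈ y′ → (x ∙ y) ≈ (x′ ∙ y′)
    ⁻¹-cong : ∀ {x x′} → x ≈ x′ → (x ⁻¹) ≈ (x′ ⁻¹)

open Str

Countable : Str → Set
Countable M = Σ (ℕ → Carrier M) λ e → ∀ x → ∃ λ i → _≈_ M (e i) x

record _≅_ (M N : Str) : Set where
  field
    f      : Carrier M → Carrier N
    f-cong : ∀ {x y} → _≈_ M x y → _≈_ N (f x) (f y)
    f-inj  : ∀ {x y} → _≈_ N (f x) (f y) → _≈_ M x y
    f-surj : ∀ y → ∃ λ x → _≈_ N (f x) y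
    f-∙    : ∀ x y → _≈_ N (f (_∙_ M x y)) (_∙_ N (f x) (f y))
    f-⁻¹   : ∀ x → _≈_ N (f (_⁻¹ M x)) (_⁻¹ N (f x))
    f-ε    : _≈_ N (f (ε M)) (ε N)

data Term (n : ℕ) : Set where
  var : Fin n → Term n
  _·_ : Term n → Term n → Term n
  inv : Term n → Term n
  e   : Term n

data QF (n : ℕ) : Set where
  _≐_  : Term n → Term n → QF n
  ¬ᶠ_  : QF n → QF n
  _∧ᶠ_ : QF n → QF n → QF n
  _∨ᶠ_ : QF n → QF n → QF n

-- Σ_{a+1}: countable disjunction (indexed by ℕ) of formulas ∃x₁…x_k ψ
--          with ψ ∈ Π_a;
-- Π_{a+1}: countable conjunction (indexed by ℕ) of formulas ∀x₁…x_k ψ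
--          with ψ ∈ Σ_a.
-- The k new variables are the first k of the Fin (k + n) context.
mutual
  Σf : ℕ → ℕ → Set
  Σf zero    n = QF n
  Σf (suc a) n = ℕ → Σ ℕ λ k → Πf a (k + n)

  Πf : ℕ → ℕ → Set
  Πf zero    n = QF n
  Πf (suc a) n = ℕ → Σ ℕ λ k → Σf a (k + n)

Σ-sentence Π-sentence : ℕ → Set
Σ-sentence a = Σf a 0
Π-sentence a = Πf a 0

module _ (M : Str) where
  private
    C = Carrier M

  ⟦_⟧t : ∀ {n} → Term n → Vector C n → C
  ⟦ var i ⟧t ρ = ρ i
  ⟦ s · t ⟧t ρ = _∙_ M (⟦ s ⟧t ρ) (⟦ t ⟧t ρ)
  ⟦ inv t ⟧t ρ = _⁻¹ M (⟦ t ⟧t ρ)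
  ⟦ e ⟧t     ρ = ε M

  satQF : ∀ {n} → QF n → Vector C n → Set
  satQF (s ≐ t)  ρ = _≈_ M (⟦ s ⟧t ρ) (⟦ t ⟧t ρ)
  satQF (¬ᶠ φ)   ρ = ¬ satQF φ ρ
  satQF (φ ∧ᶠ ψ) ρ = satQF φ ρ × satQF ψ ρ
  satQF (φ ∨ᶠ ψ) ρ = satQF φ ρ ⊎ satQF ψ ρ

  mutual
    satΣ : ∀ a {n} → Σf a n → Vector C n → Set
    satΣ zero    φ ρ = satQF φ ρ
    satΣ (suc a) φ ρ =
      ∃ λ i → ∃ λ (xs : Vector C (proj₁ (φ i))) → satΠ a (proj₂ (φ i)) (xs ++ ρ)

    satΠ : ∀ a {n} → Πf a n → Vector C n → Set
    satΠ zero    φ ρ = satQF φ ρ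
    satΠ (suc a) φ ρ =
      ∀ i → ∀ (xs : Vector C (proj₁ (φ i))) → satΣ a (proj₂ (φ i)) (xs ++ ρ)

  private
    ρ₀ : Vector C 0
    ρ₀ ()

  _⊨Σ_ : ∀ a → Σ-sentence a → Set
  _⊨Σ_ a φ = satΣ a φ ρ₀

  _⊨Π_ : ∀ a → Π-sentence a → Set
  _⊨Π_ a φ = satΠ a φ ρ₀

IsScottΣ : (A : Str) (a : ℕ) → Σ-sentence a → Set₁
IsScottΣ A a φ = ∀ (M : Str) → Countable M → ((M ⊨Σ a) φ ⇔ (M ≅ A))

IsScottΠ : (A : Str) (a : ℕ) → Π-sentence a → Set₁
IsScottΠ A a φ = ∀ (M : Str) → Countable M → ((M ⊨Π a) φ ⇔ (M ≅ A))

-- Scott complexity exactly Π_a: there is a Π_a Scott sentence but no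
-- Σ_a Scott sentence (Σ_a contains Σ_b, Π_b, d-Σ_b for all b < a).
ScottComplexityΠ : Str → ℕ → Set₁
ScottComplexityΠ A a =
  (Σ (Π-sentence a) λ φ → IsScottΠ A a φ) × ¬ (Σ (Σ-sentence a) λ φ → IsScottΣ A a φ)

-- The group (ℤ_m)^(ω): finitely supported sequences, represented by
-- lists of naturals (padded with zeros), compared pointwise modulo m.

lk : List ℕ → ℕ → ℕ
lk []       _       = 0
lk (x ∷ xs) zero    = x
lk (x ∷ xs) (suc i) = lk xs i

addL : List ℕ → List ℕ → List ℕ
addL []       ys       = ys
addL (x ∷ xs) []       = x ∷ xs
addL (x ∷ xs) (y ∷ ys) = (x + y) ∷ addL xs ys

lk-add : ∀ xs ys i → lk (addL xs ys) i ≡ lk xs i + lk ys i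
lk-add []       ys       i       = refl
lk-add (x ∷ xs) []       zero    = sym (+-identityʳ x)
lk-add (x ∷ xs) []       (suc i) = sym (+-identityʳ (lk xs i))
lk-add (x ∷ xs) (y ∷ ys) zero    = refl
lk-add (x ∷ xs) (y ∷ ys) (suc i) = lk-add xs ys i

0%n≡0 : ∀ m .{{_ : NonZero m}} → 0 % m ≡ 0
0%n≡0 (suc k) = refl

module ZMod (m : ℕ) .{{_ : NonZero m}} where

  negL : List ℕ → List ℕ
  negL = map (λ a → m ∸ a % m)

  lk-neg : ∀ xs i → lk (negL xs) i % m ≡ (m ∸ lk xs i % m) % m
  lk-neg []       i       = trans (0%n≡0 m) (sym (trans (cong (λ z → (m ∸ z) % m) (0%n≡0 m)) (n%n≡0 m)))
  lk-neg (x ∷ xs) zero    = refl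
  lk-neg (x ∷ xs) (suc i) = lk-neg xs i

  _≈m_ : List ℕ → List ℕ → Set
  xs ≈m ys = ∀ i → lk xs i % m ≡ lk ys i % m

  ≈m-equiv : IsEquivalence _≈m_
  ≈m-equiv = record
    { refl  = λ i → refl
    ; sym   = λ p i → sym (p i)
    ; trans = λ p q i → trans (p i) (q i)
    }

  add-cong : ∀ {x x′ y y′} → x ≈m x′ → y ≈m y′ → addL x y ≈m addL x′ y′
  add-cong {x} {x′} {y} {y′} p q i =
    trans (cong (_% m) (lk-add x y i))
    (trans (%-distribˡ-+ (lk x i) (lk y i) m)
    (trans (cong₂ (λ a b → (a + b) % m) (p i) (q i))
    (trans (sym (%-distribˡ-+ (lk x′ i) (lk y′ i) m))
           (sym (cong (_% m) (lk-add x′ y′ i))))))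

  neg-cong : ∀ {x x′} → x ≈m x′ → negL x ≈m negL x′
  neg-cong {x} {x′} p i =
    trans (lk-neg x i) (trans (cong (λ z → (m ∸ z) % m) (p i)) (sym (lk-neg x′ i)))

  ZmOmega : Str
  ZmOmega = record
    { Carrier = List ℕ
    ; _≈_     = _≈m_
    ; isEquiv = ≈m-equiv
    ; _∙_     = addL
    ; _⁻¹     = negL
    ; ε       = []
    ; ∙-cong  = λ {x} {x′} {y} {y′} → add-cong {x} {x′} {y} {y′}
    ; ⁻¹-cong = λ {x} {x′} → neg-cong {x} {x′}
    }

ZpnOmega : (p n : ℕ) → Prime p → Str
ZpnOmega p n (Data.Nat.Primality.prime {{nt}} _) =
  ZMod.ZmOmega (p ^ n) {{m^n≢0 p n {{Data.Nat.nonTrivial⇒nonZero p {{nt}}}}}}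

-- Write m = p ^ (n + 1). In an abelian group of exponent m, call a tuple independent if it satisfies
-- no nontrivial relation with coefficients modulo m. Over ℤ/m every non-multiple of p is a unit, which
-- gives the Steinitz exchange lemma: an independent tuple inside the span of N elements has length at
-- most N, and can be completed to a tuple of length N with the same span.
--
-- Π₂ Scott sentence: the abelian group axioms, m x = 0, and "every x₁ … x_r lies in the span of an
-- independent tuple of length at least r", which is Π₂ because the coefficients can be bounded by m.
-- In a countable model, exchange lets an independent tuple be extended to absorb the next element of
-- an enumeration while keeping it as an initial segment; the limit is a basis, giving (ℤ_m)^(ω).
--
-- No Σ₂ Scott sentence: if (ℤ_m)^(ω) ⊨ ∃x̄ θ(x̄) with θ Π₁, the witnesses x̄ use only the first K
-- coordinates. Truncation to those coordinates presents (ℤ_m)^K as a structure embedded in (ℤ_m)^(ω)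
-- and containing x̄, so it satisfies θ(x̄) and hence the sentence; but it is spanned by K elements,
-- whereas (ℤ_m)^(ω) contains K + 1 independent ones.

module Submission where

open import Defs
open import Level using (0ℓ)
open import Algebra.Bundles using (RawMonoid; AbelianGroup)
import Algebra.Definitions.RawMonoid as RawMonoidDefinitions
import Algebra.Properties.CommutativeMonoid.Mult as Mult
import Algebra.Properties.CommutativeMonoid.Sum as Sum
import Algebra.Properties.CommutativeSemigroup as CommutativeSemigroupProperties
import Algebra.Properties.Group as GroupProperties
open import Data.Fin as Fin using (Fin; zero; suc; toℕ; fromℕ<; _↑ˡ_; _↑ʳ_; splitAt; join)
open import Data.Fin.Properties
  using (toℕ-injective; toℕ<n; toℕ-inject≤; toℕ-fromℕ<; join-splitAt; ¬∀⟶∃¬; all?)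
open import Data.List using (List; []; _∷_; length; take)
open import Data.List.Properties using (length-tabulate; take-all; take-take)
open import Data.Nat
  using (ℕ; zero; suc; _+_; _*_; _∸_; _^_; _%_; _/_; _≤_; _<_; _≥_; _≤′_; z≤n; s≤s; ≤′-refl; ≤′-step;
         _≟_; _<?_; NonZero; ≢-nonZero⁻¹; nonTrivial⇒n>1)
open import Data.Nat.Coprimality using (Coprime; coprime-divisor; coprime-Bézout)
open import Data.Nat.Divisibility using (_∣_; _∤_; _∣?_; ∣-trans; ∣1⇒≡1; *-monoʳ-∣; n∣m⇒m%n≡0; m%n≡0⇒n∣m)
open import Data.Nat.DivMod
  using (m≡m%n+[m/n]*n; m%n%n≡m%n; [m+n]%n≡m%n; [m+kn]%n≡m%n; %-distribˡ-+; %-distribˡ-*; m*n%n≡0;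
         n%n≡0; m%n<n; m%n≤n; m<n⇒m%n≡m)
open import Data.Nat.GCD using (module Bézout)
open import Data.Nat.Primality using (Prime; prime; prime⇒nonZero; prime⇒nonTrivial; prime⇒irreducible)
open import Data.Nat.Properties
  using (+-assoc; +-comm; +-identityʳ; +-suc; *-comm; *-assoc; *-zeroʳ; *-identityʳ; suc-injective; suc-pred;
         m∸n+n≡m; ⊓-idem; m^n≢0; ≤-refl; ≤-trans; ≤-reflexive; ≤-total; ≤⇒≤′; m≤m+n; m≤n+m; ≮⇒≥;
         m<n⇒m<1+n; m≤n⇒m<n∨m≡n; m<m*n; 1+n≰n)
open import Data.Nat.Tactic.RingSolver using (solve-∀)
open import Data.Product using (Σ; ∃; _×_; _,_; proj₁; proj₂)
open import Data.Sum using (inj₁; inj₂; [_,_])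
open import Data.Vec as Vec using (Vec; []; _∷_; lookup)
open import Data.Vec.Properties using (lookup∘tabulate)
open import Data.Vec.Functional as Vector using (Vector; head; tail; removeAt; insertAt; _++_; toList)
open import Data.Vec.Functional.Properties
  using (lookup-++-<; lookup-++ˡ; lookup-++ʳ; removeAt-punchOut; insertAt-lookup; insertAt-punchIn; removeAt-insertAt)
open import Data.Vec.Relation.Unary.All using (All; []; _∷_)
import Data.Vec.Relation.Unary.All as All
import Data.Vec.Relation.Unary.All.Properties as All
open import Function using (case_of_)
open import Function.Bundles using (Equivalence; mk⇔)
open import Relation.Binary using (IsEquivalence)
open import Relation.Binary.PropositionalEquality as ≡ using (_≡_; _≢_; cong₂)
import Relation.Binary.Reasoning.Setoid as SetoidReasoning
open import Relation.Nullary using (¬_; Dec; yes; no; contradiction)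

[c+[m∸1]*d]%m≡0⇒c≡d : ∀ {m} .{{_ : NonZero m}} c d → (c + (m ∸ 1) * d) % m ≡ 0 → c % m ≡ d % m
[c+[m∸1]*d]%m≡0⇒c≡d {m@(suc k)} c d eq = begin
  c % m                             ≡⟨ [m+kn]%n≡m%n c d m ⟨
  (c + d * m) % m                   ≡⟨ ≡.cong (_% m) (regroup c d k) ⟩
  (c + k * d + d) % m               ≡⟨ %-distribˡ-+ (c + k * d) d m ⟩
  ((c + k * d) % m + d % m) % m     ≡⟨ ≡.cong (λ r → (r + d % m) % m) eq ⟩
  (d % m) % m                       ≡⟨ m%n%n≡m%n d m ⟩
  d % m                             ∎
  where
  open ≡.≡-Reasoning
  regroup : ∀ c d k → c + d * suc k ≡ c + k * d + d
  regroup = solve-∀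

a%m≡0⇒[a*b+c]%m≡c%m : ∀ {m} .{{_ : NonZero m}} a b c → a % m ≡ 0 → (a * b + c) % m ≡ c % m
a%m≡0⇒[a*b+c]%m≡c%m {m} a b c a≡0 = begin
  (a * b + c) % m                   ≡⟨ %-distribˡ-+ (a * b) c m ⟩
  ((a * b) % m + c % m) % m         ≡⟨ ≡.cong (λ t → (t + c % m) % m) ab≡0 ⟩
  (c % m) % m                       ≡⟨ m%n%n≡m%n c m ⟩
  c % m                             ∎
  where
  open ≡.≡-Reasoning
  ab≡0 : (a * b) % m ≡ 0
  ab≡0 = ≡.trans (%-distribˡ-* a b m) (≡.trans (≡.cong (λ t → (t * (b % m)) % m) a≡0) (0%n≡0 m))

bézout⇒inverse : ∀ {m} .{{_ : NonZero m}} {a} → Bézout.Identity 1 m a → ∃ λ u → (u * a) % m ≡ 1 % m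
bézout⇒inverse {m} {a} (Bézout.-+ x y 1+xm≡ya) = y , ≡.trans (≡.cong (_% m) (≡.sym 1+xm≡ya)) ([m+kn]%n≡m%n 1 x m)
bézout⇒inverse {m@(suc k)} {a} (Bézout.+- x y 1+ya≡xm) = k * y , (begin
  (k * y * a) % m                ≡⟨ [m+n]%n≡m%n (k * y * a) m ⟨
  (k * y * a + m) % m            ≡⟨ ≡.cong (_% m) (regroup k y a) ⟩
  (1 + k * (1 + y * a)) % m      ≡⟨ ≡.cong (λ t → (1 + k * t) % m) 1+ya≡xm ⟩
  (1 + k * (x * m)) % m          ≡⟨ ≡.cong (λ t → (1 + t) % m) (*-assoc k x m) ⟨
  (1 + k * x * m) % m            ≡⟨ [m+kn]%n≡m%n 1 (k * x) m ⟩
  1 % m                          ∎)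
  where
  open ≡.≡-Reasoning
  regroup : ∀ k y a → k * y * a + suc k ≡ 1 + k * (1 + y * a)
  regroup = solve-∀

module PrimePower {p : ℕ} (p-prime : Prime p) (n : ℕ) where

  instance
    p≢0 : NonZero p
    p≢0 = prime⇒nonZero p-prime

    p^[1+n]≢0 : NonZero (p ^ suc n)
    p^[1+n]≢0 = m^n≢0 p (suc n)

  p^n%p^[1+n]≢0 : (p ^ n) % p ^ suc n ≢ 0
  p^n%p^[1+n]≢0 eq = ≢-nonZero⁻¹ (p ^ n) {{m^n≢0 p n}} (≡.trans (≡.sym (m<n⇒m%n≡m p^n<p^[1+n])) eq)
    where
    p^n<p^[1+n] : p ^ n < p ^ suc n
    p^n<p^[1+n] = ≡.subst (p ^ n <_) (*-comm (p ^ n) p)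
                    (m<m*n (p ^ n) p {{m^n≢0 p n}} (nonTrivial⇒n>1 p {{prime⇒nonTrivial p-prime}}))

  p∣a⇒p^n*a%p^[1+n]≡0 : ∀ {a} → p ∣ a → (p ^ n * a) % p ^ suc n ≡ 0
  p∣a⇒p^n*a%p^[1+n]≡0 {a} p∣a =
    n∣m⇒m%n≡0 (p ^ n * a) (p ^ suc n) (≡.subst (_∣ p ^ n * a) (*-comm (p ^ n) p) (*-monoʳ-∣ (p ^ n) p∣a))

  p∤a⇒coprime : ∀ {a} → p ∤ a → ∀ k → Coprime (p ^ k) a
  p∤a⇒coprime p∤a zero    (d∣1 , _)   = ∣1⇒≡1 d∣1
  p∤a⇒coprime p∤a (suc k) (d∣p^[1+k] , d∣a) = p∤a⇒coprime p∤a k (coprime-divisor d⊥p d∣p^[1+k] , d∣a)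
    where
    d⊥p : Coprime _ p
    d⊥p (c∣d , c∣p) with prime⇒irreducible p-prime c∣p
    ... | inj₁ c≡1 = c≡1
    ... | inj₂ c≡p = contradiction (≡.subst (_∣ _) c≡p (∣-trans c∣d d∣a)) p∤a

  p∤a⇒invertible : ∀ {a} → p ∤ a → ∃ λ u → (u * a) % p ^ suc n ≡ 1 % p ^ suc n
  p∤a⇒invertible p∤a = bézout⇒inverse (coprime-Bézout (p∤a⇒coprime p∤a (suc n)))

  p∤a⇒cancel : ∀ {a c} → p ∤ a → (c * a) % p ^ suc n ≡ 0 → c % p ^ suc n ≡ 0
  p∤a⇒cancel {a} {c} p∤a ca≡0 = n∣m⇒m%n≡0 c (p ^ suc n)
    (coprime-divisor (p∤a⇒coprime p∤a (suc n))
      (≡.subst (p ^ suc n ∣_) (*-comm c a) (m%n≡0⇒n∣m (c * a) (p ^ suc n) ca≡0)))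

↑-elim : ∀ {k l} {P : Fin (k + l) → Set} → (∀ i → P (i ↑ˡ l)) → (∀ j → P (k ↑ʳ j)) → ∀ i → P i
↑-elim {k} {l} {P} left right i =
  ≡.subst P (join-splitAt k l i) ([_,_] {C = λ s → P (join k l s)} left right (splitAt k i))

prefix : ∀ {A : Set} N → (ℕ → A) → Vector A N
prefix N s i = s (toℕ i)

lk-≥length : ∀ xs {i} → length xs ≤ i → lk xs i ≡ 0
lk-≥length []                _        = ≡.refl
lk-≥length (x ∷ xs) {suc i} (s≤s le) = lk-≥length xs le

lk-toList : ∀ {k} (cs : Vector ℕ k) j → lk (toList cs) (toℕ j) ≡ cs j
lk-toList cs zero    = ≡.refl
lk-toList cs (suc j) = lk-toList (tail cs) j

lk-take-< : ∀ K xs {i} → i < K → lk (take K xs) i ≡ lk xs i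
lk-take-< (suc K) []                _        = ≡.refl
lk-take-< (suc K) (x ∷ xs) {zero}  _        = ≡.refl
lk-take-< (suc K) (x ∷ xs) {suc i} (s≤s lt) = lk-take-< K xs lt

lk-take-≥ : ∀ K xs {i} → K ≤ i → lk (take K xs) i ≡ 0
lk-take-≥ zero    xs                _        = ≡.refl
lk-take-≥ (suc K) []                _        = ≡.refl
lk-take-≥ (suc K) (x ∷ xs) {suc i} (s≤s le) = lk-take-≥ K xs le

coordinates : ∀ K → List ℕ → Vector ℕ K
coordinates K xs j = lk xs (toℕ j)

lk-toList-coordinates : ∀ K xs i → lk (toList (coordinates K xs)) i ≡ lk (take K xs) i
lk-toList-coordinates zero          xs       i       = ≡.refl
lk-toList-coordinates (suc K)       []       zero    = ≡.refl
lk-toList-coordinates (suc zero)    []       (suc i) = ≡.refl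
lk-toList-coordinates (suc (suc K)) []       (suc i) = lk-toList-coordinates (suc K) [] i
lk-toList-coordinates (suc K)       (x ∷ xs) zero    = ≡.refl
lk-toList-coordinates (suc K)       (x ∷ xs) (suc i) = lk-toList-coordinates K xs i

Σlength : ∀ {r} → Vector (List ℕ) r → ℕ
Σlength {zero}  xss = 0
Σlength {suc r} xss = length (head xss) + Σlength (tail xss)

length≤Σlength : ∀ {r} (xss : Vector (List ℕ) r) t → length (xss t) ≤ Σlength xss
length≤Σlength xss zero    = m≤m+n _ _
length≤Σlength xss (suc t) = ≤-trans (length≤Σlength (tail xss) t) (m≤n+m _ _)

private
  step : ℕ × ℕ → ℕ × ℕ
  step (a , zero)  = 0 , suc a
  step (a , suc b) = suc a , b

unpair : ℕ → ℕ × ℕ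
unpair zero    = 0 , 0
unpair (suc k) = step (unpair k)

unpair-surjective : ∀ a b → ∃ λ k → unpair k ≡ (a , b)
unpair-surjective a b = along-diagonal (a + b) a b ≡.refl
  where
  along-diagonal : ∀ s a b → a + b ≡ s → ∃ λ k → unpair k ≡ (a , b)
  along-diagonal zero    zero    zero    _   = 0 , ≡.refl
  along-diagonal (suc s) zero    (suc b) eq  with along-diagonal s b 0 (≡.trans (+-identityʳ b) (suc-injective eq))
  ... | k , unpair-k = suc k , ≡.cong step unpair-k
  along-diagonal s       (suc a) b       eq  with along-diagonal s a (suc b) (≡.trans (+-suc a b) eq)
  ... | k , unpair-k = suc k , ≡.cong step unpair-k

decodeList : ℕ → ℕ → List ℕ
decodeList zero    k = []
decodeList (suc l) k = proj₁ (unpair k) ∷ decodeList l (proj₂ (unpair k))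

decode : ℕ → List ℕ
decode k = decodeList (proj₁ (unpair k)) (proj₂ (unpair k))

decodeList-surjective : ∀ xs → ∃ λ k → decodeList (length xs) k ≡ xs
decodeList-surjective []       = 0 , ≡.refl
decodeList-surjective (x ∷ xs) with decodeList-surjective xs
... | k , decoded with unpair-surjective x k
... | k′ , unpair-k′ =
  k′ , ≡.trans (≡.cong (λ (a , b) → a ∷ decodeList (length xs) b) unpair-k′) (≡.cong (x ∷_) decoded)

decode-surjective : ∀ xs → ∃ λ k → decode k ≡ xs
decode-surjective xs with decodeList-surjective xs
... | k , decoded with unpair-surjective (length xs) k
... | k′ , unpair-k′ = k′ , ≡.trans (≡.cong (λ (l , c) → decodeList l c) unpair-k′) decoded

module Combination (M : Str) where
  open Str M

  rawMonoid : RawMonoid 0ℓ 0ℓ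
  rawMonoid = record { Carrier = Carrier ; _≈_ = _≈_ ; _∙_ = _∙_ ; ε = ε }

  open RawMonoidDefinitions rawMonoid public using (sum) renaming (_×_ to _•_)

  lc : ∀ {k} → Vector ℕ k → Vector Carrier k → Carrier
  lc cs xs = sum (λ i → cs i • xs i)

  -- Span and Independent are records rather than Σ- and Π-types so that xs can be inferred from a proof.
  record Span {k} (xs : Vector Carrier k) (y : Carrier) : Set where
    constructor span
    field
      coefficients : Vector ℕ k
      equation     : y ≈ lc coefficients xs

  Spans : ∀ {k l} → Vector Carrier k → Vector Carrier l → Set
  Spans xs ys = ∀ i → Span xs (ys i)

module Independence (M : Str) (m : ℕ) .{{_ : NonZero m}} where
  open Str M
  open Combination M public

  record Independent {k} (xs : Vector Carrier k) : Set where
    constructor independent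
    field
      relation-trivial : ∀ cs → lc cs xs ≈ ε → ∀ i → cs i % m ≡ 0

  ReducedIndependent : ∀ {k} → Vector Carrier k → Set
  ReducedIndependent {k} xs = ∀ (cs : Vec ℕ k) → All (_< m) cs → lc (lookup cs) xs ≈ ε → All (_≡ 0) cs

  ReducedSpan : ∀ {k} → Vector Carrier k → Carrier → Set
  ReducedSpan {k} xs y = ∃ λ (cs : Vec ℕ k) → All (_< m) cs × y ≈ lc (lookup cs) xs

  IndependentlySpanned : Set
  IndependentlySpanned =
    ∀ r (xs : Vector Carrier r) → ∃ λ j → Σ (Vector Carrier (j + r)) λ zs → Independent zs × Spans zs xs


record IsAbelianGroupOfExponent (M : Str) (m : ℕ) : Set where
  open Str M
  open Combination M using (_•_)

  field
    assoc     : ∀ x y z → ((x ∙ y) ∙ z) ≈ (x ∙ (y ∙ z))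
    comm      : ∀ x y → (x ∙ y) ≈ (y ∙ x)
    identityˡ : ∀ x → (ε ∙ x) ≈ x
    inverseˡ  : ∀ x → ((x ⁻¹) ∙ x) ≈ ε
    exponent  : ∀ x → (m • x) ≈ ε

  private module E = IsEquivalence isEquiv

  abelianGroup : AbelianGroup 0ℓ 0ℓ
  abelianGroup = record
    { Carrier = Carrier ; _≈_ = _≈_ ; _∙_ = _∙_ ; ε = ε ; _⁻¹ = _⁻¹
    ; isAbelianGroup = record
      { isGroup = record
        { isMonoid = record
          { isSemigroup = record
            { isMagma = record { isEquivalence = isEquiv ; ∙-cong = ∙-cong }
            ; assoc = assoc }
          ; identity = identityˡ , λ x → E.trans (comm x ε) (identityˡ x) }
        ; inverse = inverseˡ , λ x → E.trans (comm x (x ⁻¹)) (inverseˡ x)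
        ; ⁻¹-cong = ⁻¹-cong }
      ; comm = comm } }

record _↪_ (M N : Str) : Set where
  field
    f      : Str.Carrier M → Str.Carrier N
    f-cong : ∀ {x y} → Str._≈_ M x y → Str._≈_ N (f x) (f y)
    f-inj  : ∀ {x y} → Str._≈_ N (f x) (f y) → Str._≈_ M x y
    f-∙    : ∀ x y → Str._≈_ N (f (Str._∙_ M x y)) (Str._∙_ N (f x) (f y))
    f-⁻¹   : ∀ x → Str._≈_ N (f (Str._⁻¹ M x)) (Str._⁻¹ N (f x))
    f-ε    : Str._≈_ N (f (Str.ε M)) (Str.ε N)

≅⇒↪ : ∀ {M N} → M ≅ N → M ↪ N
≅⇒↪ iso = record { f = f ; f-cong = f-cong ; f-inj = f-inj ; f-∙ = f-∙ ; f-⁻¹ = f-⁻¹ ; f-ε = f-ε }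
  where open _≅_ iso

≅-refl : ∀ {M} → M ≅ M
≅-refl {M} = record
  { f = λ x → x ; f-cong = λ x≈y → x≈y ; f-inj = λ x≈y → x≈y ; f-surj = λ x → x , refl
  ; f-∙ = λ _ _ → refl ; f-⁻¹ = λ _ → refl ; f-ε = refl }
  where open IsEquivalence (Str.isEquiv M)

≅-sym : ∀ {M N} → M ≅ N → N ≅ M
≅-sym {M} {N} iso = record
  { f      = g
  ; f-cong = λ {y} {y′} y≈y′ → f-inj (N.trans (fg y) (N.trans y≈y′ (N.sym (fg y′))))
  ; f-inj  = λ {y} {y′} gy≈gy′ → N.trans (N.sym (fg y)) (N.trans (f-cong gy≈gy′) (fg y′))
  ; f-surj = λ x → f x , f-inj (fg (f x))
  ; f-∙    = λ y y′ → f-inj (N.trans (fg (y ∙ₙ y′))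
                        (N.trans (∙-congₙ (N.sym (fg y)) (N.sym (fg y′))) (N.sym (f-∙ (g y) (g y′)))))
  ; f-⁻¹   = λ y → f-inj (N.trans (fg (y ⁻¹ₙ)) (N.trans (⁻¹-congₙ (N.sym (fg y))) (N.sym (f-⁻¹ (g y)))))
  ; f-ε    = f-inj (N.trans (fg εₙ) (N.sym f-ε))
  }
  where
  open _≅_ iso
  module N = IsEquivalence (Str.isEquiv N)
  open Str N using () renaming (_∙_ to _∙ₙ_; _⁻¹ to _⁻¹ₙ; ε to εₙ; ∙-cong to ∙-congₙ; ⁻¹-cong to ⁻¹-congₙ)
  g : Str.Carrier N → Str.Carrier M
  g y = proj₁ (f-surj y)
  fg : ∀ y → Str._≈_ N (f (g y)) y
  fg y = proj₂ (f-surj y)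

countable-by : ∀ {M} (enum : ℕ → Str.Carrier M) → (∀ x → ∃ λ i → enum i ≡ x) → Countable M
countable-by {M} enum surj = enum , λ x → proj₁ (surj x) , IsEquivalence.reflexive (Str.isEquiv M) (proj₂ (surj x))

module _ {M N : Str} (h : M ↪ N) where
  open _↪_ h
  open Str N using (_≈_; ∙-cong)
  open IsEquivalence (Str.isEquiv N)
  private
    module CM = Combination M
    module CN = Combination N

  ↪-• : ∀ c x → f (c CM.• x) ≈ (c CN.• f x)
  ↪-• zero    x = f-ε
  ↪-• (suc c) x = trans (f-∙ x (c CM.• x)) (∙-cong refl (↪-• c x))

  ↪-lc : ∀ {k} (cs : Vector ℕ k) xs → f (CM.lc cs xs) ≈ CN.lc cs (λ i → f (xs i))
  ↪-lc {zero}  cs xs = f-ε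
  ↪-lc {suc k} cs xs = trans (f-∙ _ _) (∙-cong (↪-• (cs zero) (xs zero)) (↪-lc (tail cs) (tail xs)))

record Endomorphism (N : Str) : Set where
  open Str N
  field
    h      : Carrier → Carrier
    h-cong : ∀ {x y} → x ≈ y → h x ≈ h y
    h-∙    : ∀ x y → h (x ∙ y) ≈ (h x ∙ h y)
    h-⁻¹   : ∀ x → h (x ⁻¹) ≈ (h x ⁻¹)
    h-ε    : h ε ≈ ε

module Image {N : Str} (endo : Endomorphism N) where
  open Endomorphism endo
  open Str N
  private module E = IsEquivalence isEquiv

  image : Str
  image = record
    { Carrier = Carrier
    ; _≈_     = λ x y → h x ≈ h y
    ; isEquiv = record { refl = E.refl ; sym = E.sym ; trans = E.trans }
    ; _∙_     = _∙_
    ; _⁻¹     = _⁻¹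
    ; ε       = ε
    ; ∙-cong  = λ x≈x′ y≈y′ → E.trans (h-∙ _ _) (E.trans (∙-cong x≈x′ y≈y′) (E.sym (h-∙ _ _)))
    ; ⁻¹-cong = λ x≈x′ → E.trans (h-⁻¹ _) (E.trans (⁻¹-cong x≈x′) (E.sym (h-⁻¹ _)))
    }

  image↪ : image ↪ N
  image↪ = record
    { f = h ; f-cong = λ x≈y → x≈y ; f-inj = λ x≈y → x≈y ; f-∙ = h-∙ ; f-⁻¹ = h-⁻¹ ; f-ε = h-ε }

module Linear {M : Str} {m : ℕ} .{{_ : NonZero m}} (G : IsAbelianGroupOfExponent M m) where
  open Independence M m public using (lc; Span; span; Spans; Independent; independent; ReducedIndependent; ReducedSpan)
  open Independent public
  open IsAbelianGroupOfExponent G using (abelianGroup; exponent)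
  open AbelianGroup abelianGroup public
  open Sum commutativeMonoid
  open Mult commutativeMonoid public renaming (_×_ to _•_)
  open GroupProperties group using (inverseʳ-unique)
  open SetoidReasoning setoid

  •-ε : ∀ n → n • ε ≈ ε
  •-ε zero    = refl
  •-ε (suc n) = trans (identityˡ _) (•-ε n)

  •-mod : ∀ {a b} x → a % m ≡ b % m → a • x ≈ b • x
  •-mod {a} {b} x eq = begin
    a • x       ≈⟨ reduce a ⟩
    (a % m) • x ≡⟨ ≡.cong (_• x) eq ⟩
    (b % m) • x ≈⟨ reduce b ⟨
    b • x       ∎
    where
    reduce : ∀ a → a • x ≈ (a % m) • x
    reduce a = begin
      a • x                         ≡⟨ ≡.cong (_• x) (m≡m%n+[m/n]*n a m) ⟩
      (a % m + a / m * m) • x       ≈⟨ ×-homo-+ x (a % m) (a / m * m) ⟩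
      (a % m) • x ∙ (a / m * m) • x ≈⟨ ∙-congˡ (×-assocˡ x (a / m) m) ⟨
      (a % m) • x ∙ (a / m) • m • x ≈⟨ ∙-congˡ (trans (×-congʳ (a / m) (exponent x)) (•-ε (a / m))) ⟩
      (a % m) • x ∙ ε               ≈⟨ identityʳ _ ⟩
      (a % m) • x                   ∎

  ⁻¹≈• : ∀ x → x ⁻¹ ≈ (m ∸ 1) • x
  ⁻¹≈• x = sym (inverseʳ-unique x _ (trans (×-congˡ (suc-pred m)) (exponent x)))

  lc-congˡ : ∀ {k} {cs ds : Vector ℕ k} xs → (∀ i → cs i % m ≡ ds i % m) → lc cs xs ≈ lc ds xs
  lc-congˡ {k} xs cs≡ds = sum-cong-≋ {k} λ i → •-mod (xs i) (cs≡ds i)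

  lc-congʳ : ∀ {k} cs {xs ys : Vector Carrier k} → (∀ i → xs i ≈ ys i) → lc cs xs ≈ lc cs ys
  lc-congʳ {k} cs xs≈ys = sum-cong-≋ {k} λ i → ×-congʳ (cs i) (xs≈ys i)

  lc-zero : ∀ {k} {cs : Vector ℕ k} (xs : Vector Carrier k) → (∀ i → cs i % m ≡ 0) → lc cs xs ≈ ε
  lc-zero {k} xs cs≡0 = trans (lc-congˡ {ds = λ _ → 0} xs (λ i → ≡.trans (cs≡0 i) (≡.sym (0%n≡0 m))))
                              (sum-replicate-zero k)

  lc-+ : ∀ {k} (cs ds : Vector ℕ k) xs → lc (λ i → cs i + ds i) xs ≈ lc cs xs ∙ lc ds xs
  lc-+ {k} cs ds xs = trans (sum-cong-≋ {k} λ i → ×-homo-+ (xs i) (cs i) (ds i))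
                             (∑-distrib-+ (λ i → cs i • xs i) (λ i → ds i • xs i))

  lc-* : ∀ {k} a (cs : Vector ℕ k) xs → lc (λ i → a * cs i) xs ≈ a • lc cs xs
  lc-* {zero}  a cs xs = sym (•-ε a)
  lc-* {suc k} a cs xs = begin
    (a * cs zero) • xs zero ∙ lc (λ i → a * cs (suc i)) (tail xs)
      ≈⟨ ∙-cong (sym (×-assocˡ _ a _)) (lc-* a (tail cs) (tail xs)) ⟩
    a • cs zero • xs zero ∙ a • lc (tail cs) (tail xs)
      ≈⟨ ×-distrib-+ _ _ a ⟨
    a • lc cs xs
      ∎

  sum-↑ : ∀ {k l} (f : Vector Carrier (k + l)) → sum f ≈ sum (λ i → f (i ↑ˡ l)) ∙ sum (λ j → f (k ↑ʳ j))
  sum-↑ {zero}  f = sym (identityˡ _)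
  sum-↑ {suc k} {l} f = trans (∙-congˡ (sum-↑ {k} {l} (tail f))) (sym (assoc _ _ _))

  lc-++ : ∀ {k l} (cs : Vector ℕ (k + l)) (xs : Vector Carrier k) (ys : Vector Carrier l) →
          lc cs (xs ++ ys) ≈ lc (λ i → cs (i ↑ˡ l)) xs ∙ lc (λ j → cs (k ↑ʳ j)) ys
  lc-++ {k} {l} cs xs ys = trans (sum-↑ {k} {l} (λ i → cs i • (xs ++ ys) i)) (∙-cong
    (reflexive (sum-cong-≗ {k} λ i → ≡.cong (cs _ •_) (lookup-++ˡ xs ys i)))
    (reflexive (sum-cong-≗ {l} λ j → ≡.cong (cs _ •_) (lookup-++ʳ xs ys j))))

  lc-removeAt : ∀ {k} (cs : Vector ℕ (suc k)) xs i → lc cs xs ≈ cs i • xs i ∙ lc (removeAt cs i) (removeAt xs i)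
  lc-removeAt cs xs i = sum-remove {i = i} (λ j → cs j • xs j)

  lc-++-++ : ∀ {k l} (cs : Vector ℕ k) (ds : Vector ℕ l) xs ys → lc (cs ++ ds) (xs ++ ys) ≈ lc cs xs ∙ lc ds ys
  lc-++-++ cs ds xs ys = trans (lc-++ (cs ++ ds) xs ys) (∙-cong
    (lc-congˡ xs (λ i → ≡.cong (_% m) (lookup-++ˡ cs ds i)))
    (lc-congˡ ys (λ j → ≡.cong (_% m) (lookup-++ʳ cs ds j))))

  lc-insertAt-0 : ∀ {k} (cs : Vector ℕ k) xs i → lc (insertAt cs i 0) xs ≈ lc cs (removeAt xs i)
  lc-insertAt-0 cs xs i = begin
    lc (insertAt cs i 0) xs                                    ≈⟨ lc-removeAt (insertAt cs i 0) xs i ⟩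
    insertAt cs i 0 i • xs i ∙ lc (removeAt (insertAt cs i 0) i) (removeAt xs i)
      ≈⟨ ∙-cong (×-congˡ (insertAt-lookup cs i 0))
                (lc-congˡ (removeAt xs i) (λ j → ≡.cong (_% m) (removeAt-insertAt cs i 0 j))) ⟩
    ε ∙ lc cs (removeAt xs i)                                  ≈⟨ identityˡ _ ⟩
    lc cs (removeAt xs i)                                      ∎

  independent-injective : ∀ {k} {xs : Vector Carrier k} → Independent xs →
                          ∀ cs ds → lc cs xs ≈ lc ds xs → ∀ i → cs i % m ≡ ds i % m
  independent-injective {xs = xs} ind cs ds eq i =
    [c+[m∸1]*d]%m≡0⇒c≡d (cs i) (ds i) (relation-trivial ind (λ i → cs i + (m ∸ 1) * ds i) difference≈ε i)
    where
    difference≈ε : lc (λ i → cs i + (m ∸ 1) * ds i) xs ≈ ε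
    difference≈ε = begin
      lc (λ i → cs i + (m ∸ 1) * ds i) xs      ≈⟨ lc-+ cs _ xs ⟩
      lc cs xs ∙ lc (λ i → (m ∸ 1) * ds i) xs  ≈⟨ ∙-cong eq (lc-* (m ∸ 1) ds xs) ⟩
      suc (m ∸ 1) • lc ds xs                   ≈⟨ ×-congˡ (suc-pred m) ⟩
      m • lc ds xs                             ≈⟨ exponent _ ⟩
      ε                                        ∎

  span-resp : ∀ {k} {xs : Vector Carrier k} {y z} → y ≈ z → Span xs y → Span xs z
  span-resp y≈z (span cs y≈lc) = span cs (trans (sym y≈z) y≈lc)

  span-∙ : ∀ {k} {xs : Vector Carrier k} {y z} → Span xs y → Span xs z → Span xs (y ∙ z)
  span-∙ {xs = xs} (span cs y≈) (span ds z≈) = span (λ i → cs i + ds i) (trans (∙-cong y≈ z≈) (sym (lc-+ cs ds xs)))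

  span-• : ∀ {k} {xs : Vector Carrier k} {y} a → Span xs y → Span xs (a • y)
  span-• {xs = xs} a (span cs y≈) = span (λ i → a * cs i) (trans (×-congʳ a y≈) (sym (lc-* a cs xs)))

  span-⁻¹ : ∀ {k} {xs : Vector Carrier k} {y} → Span xs y → Span xs (y ⁻¹)
  span-⁻¹ {y = y} y-spanned = span-resp (sym (⁻¹≈• y)) (span-• (m ∸ 1) y-spanned)

  span-cancelʳ : ∀ {k} {xs : Vector Carrier k} {y z} → Span xs (y ∙ z) → Span xs z → Span xs y
  span-cancelʳ {y = y} {z} yz-spanned z-spanned = span-resp y∙z∙z⁻¹≈y (span-∙ yz-spanned (span-⁻¹ z-spanned))
    where
    y∙z∙z⁻¹≈y : y ∙ z ∙ z ⁻¹ ≈ y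
    y∙z∙z⁻¹≈y = trans (assoc y z (z ⁻¹)) (trans (∙-congˡ (inverseʳ z)) (identityʳ y))

  span-member : ∀ {k} (xs : Vector Carrier k) i → Span xs (xs i)
  span-member xs zero    = span (1 Vector.∷ λ _ → 0)
    (sym (trans (∙-cong (×-homo-1 (xs zero)) (lc-zero (tail xs) λ _ → 0%n≡0 m)) (identityʳ (xs zero))))
  span-member xs (suc i) with span-member (tail xs) i
  ... | span cs xᵢ≈lc = span (0 Vector.∷ cs) (trans xᵢ≈lc (sym (identityˡ _)))

  span-lc : ∀ {k l} {xs : Vector Carrier k} {ys : Vector Carrier l} → Spans xs ys → ∀ ds → Span xs (lc ds ys)
  span-lc {l = zero}  {xs} spans ds = span (λ _ → 0) (sym (lc-zero xs λ _ → 0%n≡0 m))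
  span-lc {l = suc l}      spans ds = span-∙ (span-• (ds zero) (spans zero)) (span-lc (λ i → spans (suc i)) (tail ds))

  span-trans : ∀ {k l} {xs : Vector Carrier k} {ys : Vector Carrier l} {z} → Spans xs ys → Span ys z → Span xs z
  span-trans spans (span ds z≈) = span-resp (sym z≈) (span-lc spans ds)

  spans-trans : ∀ {k l n} {xs : Vector Carrier k} {ys : Vector Carrier l} {zs : Vector Carrier n} →
                Spans xs ys → Spans ys zs → Spans xs zs
  spans-trans xs-ys ys-zs i = span-trans xs-ys (ys-zs i)

  span-++ˡ : ∀ {k l} {xs : Vector Carrier k} (ys : Vector Carrier l) {z} → Span xs z → Span (xs ++ ys) z
  span-++ˡ {xs = xs} ys =
    span-trans λ i → ≡.subst (Span (xs ++ ys)) (lookup-++ˡ xs ys i) (span-member (xs ++ ys) (i ↑ˡ _))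

  span-++ʳ : ∀ {k l} (xs : Vector Carrier k) {ys : Vector Carrier l} {z} → Span ys z → Span (xs ++ ys) z
  span-++ʳ xs {ys} =
    span-trans λ j → ≡.subst (Span (xs ++ ys)) (lookup-++ʳ xs ys j) (span-member (xs ++ ys) (_ ↑ʳ j))

  spans-++ : ∀ {k l n} {zs : Vector Carrier n} {xs : Vector Carrier k} {ys : Vector Carrier l} →
             Spans zs xs → Spans zs ys → Spans zs (xs ++ ys)
  spans-++ {zs = zs} {xs} {ys} xs-spanned ys-spanned =
    ↑-elim (λ i → ≡.subst (Span zs) (≡.sym (lookup-++ˡ xs ys i)) (xs-spanned i))
           (λ j → ≡.subst (Span zs) (≡.sym (lookup-++ʳ xs ys j)) (ys-spanned j))

  spans-removeAt : ∀ {k n} {zs : Vector Carrier n} {ws : Vector Carrier (suc k)} i →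
                   Span zs (ws i) → Spans zs (removeAt ws i) → Spans zs ws
  spans-removeAt {zs = zs} {ws} i wᵢ-spanned rest-spanned j with i Fin.≟ j
  ... | yes ≡.refl = wᵢ-spanned
  ... | no  i≢j    = ≡.subst (Span zs) (removeAt-punchOut ws i≢j) (rest-spanned (Fin.punchOut i≢j))

  lc-prefix-pad : ∀ {K K′} (c : ℕ → ℕ) (b : ℕ → Carrier) → K ≤ K′ → (∀ i → K ≤ i → c i % m ≡ 0) →
                  lc (prefix K′ c) (prefix K′ b) ≈ lc (prefix K c) (prefix K b)
  lc-prefix-pad {K′ = zero}  c b z≤n _   = refl
  lc-prefix-pad {zero} {suc K′} c b _ c≡0 = lc-zero (prefix (suc K′) b) (λ i → c≡0 (toℕ i) z≤n)
  lc-prefix-pad {suc K} {suc K′} c b (s≤s K≤K′) c≡0 =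
    ∙-congˡ (lc-prefix-pad (λ i → c (suc i)) (λ i → b (suc i)) K≤K′ (λ i K≤i → c≡0 (suc i) (s≤s K≤i)))

  lc-prefix-stable : ∀ {K K′} (c : ℕ → ℕ) (b : ℕ → Carrier) →
                     (∀ i → K ≤ i → c i % m ≡ 0) → (∀ i → K′ ≤ i → c i % m ≡ 0) →
                     lc (prefix K c) (prefix K b) ≈ lc (prefix K′ c) (prefix K′ b)
  lc-prefix-stable {K} {K′} c b c≡0 c≡0′ with ≤-total K K′
  ... | inj₁ K≤K′ = sym (lc-prefix-pad c b K≤K′ c≡0)
  ... | inj₂ K′≤K = lc-prefix-pad c b K′≤K c≡0′

  span-respʳ : ∀ {k} {xs ys : Vector Carrier k} {z} → (∀ i → xs i ≈ ys i) → Span xs z → Span ys z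
  span-respʳ {ys = ys} xs≈ys (span cs z≈) = span cs (trans z≈ (lc-congʳ cs xs≈ys))

  independent-respʳ : ∀ {k} {xs ys : Vector Carrier k} → (∀ i → xs i ≈ ys i) → Independent xs → Independent ys
  independent-respʳ xs≈ys ind = independent λ cs lc≈ε → relation-trivial ind cs (trans (lc-congʳ cs xs≈ys) lc≈ε)

  independent-prefix : ∀ {N D} {b : ℕ → Carrier} → N ≤ D → Independent (prefix D b) → Independent (prefix N b)
  independent-prefix {N} {D} {b} N≤D ind = independent λ cs lc≈ε j →
    ≡.subst (λ c → c % m ≡ 0) (lk-toList cs j)
      (≡.subst (λ i → lk (toList cs) i % m ≡ 0) (toℕ-inject≤ j N≤D)
        (relation-trivial ind (prefix D (lk (toList cs))) (padded≈ε cs lc≈ε) (Fin.inject≤ j N≤D)))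
    where
    padded≈ε : ∀ cs → lc cs (prefix N b) ≈ ε → lc (prefix D (lk (toList cs))) (prefix D b) ≈ ε
    padded≈ε cs lc≈ε = begin
      lc (prefix D (lk (toList cs))) (prefix D b)  ≈⟨ lc-prefix-pad (lk (toList cs)) b N≤D vanishes ⟩
      lc (prefix N (lk (toList cs))) (prefix N b)  ≈⟨ lc-congˡ (prefix N b) (λ j → ≡.cong (_% m) (lk-toList cs j)) ⟩
      lc cs (prefix N b)                           ≈⟨ lc≈ε ⟩
      ε                                            ∎
      where
      vanishes : ∀ i → N ≤ i → lk (toList cs) i % m ≡ 0
      vanishes i N≤i =
        ≡.trans (≡.cong (_% m) (lk-≥length (toList cs) (≤-trans (≤-reflexive (length-tabulate cs)) N≤i))) (0%n≡0 m)

  private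
    reduce : ∀ {k} → Vector ℕ k → Vec ℕ k
    reduce cs = Vec.tabulate (λ i → cs i % m)

    reduce-< : ∀ {k} (cs : Vector ℕ k) → All (_< m) (reduce cs)
    reduce-< cs = All.tabulate⁺ (λ i → m%n<n (cs i) m)

    lc-reduce : ∀ {k} (cs : Vector ℕ k) xs → lc (lookup (reduce cs)) xs ≈ lc cs xs
    lc-reduce cs xs = lc-congˡ xs λ i → ≡.trans (≡.cong (_% m) (lookup∘tabulate _ i)) (m%n%n≡m%n (cs i) m)

  independent⇒reduced : ∀ {k} {xs : Vector Carrier k} → Independent xs → ReducedIndependent xs
  independent⇒reduced ind cs cs<m lc≈ε = All.lookup⁻ λ i →
    ≡.trans (≡.sym (m<n⇒m%n≡m (All.lookup⁺ cs<m i))) (relation-trivial ind (lookup cs) lc≈ε i)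

  reduced⇒independent : ∀ {k} {xs : Vector Carrier k} → ReducedIndependent xs → Independent xs
  reduced⇒independent {xs = xs} ind = independent λ cs lc≈ε i →
    ≡.trans (≡.sym (lookup∘tabulate _ i))
      (All.lookup⁺ (ind (reduce cs) (reduce-< cs) (trans (lc-reduce cs xs) lc≈ε)) i)

  span⇒reduced : ∀ {k} {xs : Vector Carrier k} {y} → Span xs y → ReducedSpan xs y
  span⇒reduced {xs = xs} (span cs y≈) = reduce cs , reduce-< cs , trans y≈ (sym (lc-reduce cs xs))

  reduced⇒span : ∀ {k} {xs : Vector Carrier k} {y} → ReducedSpan xs y → Span xs y
  reduced⇒span (cs , _ , y≈) = span (lookup cs) y≈

-- The exchange lemma over ℤ/p^(n+1)

module Exchange {M : Str} {p : ℕ} (p-prime : Prime p) (n : ℕ)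
                (G : IsAbelianGroupOfExponent M (p ^ suc n)) where
  open PrimePower p-prime n
  open Linear G
  open CommutativeSemigroupProperties commutativeSemigroup using (x∙yz≈y∙xz)
  open SetoidReasoning setoid

  private
    m : ℕ
    m = p ^ suc n

  independent-tail : ∀ {k} {bs : Vector Carrier (suc k)} → Independent bs → Independent (tail bs)
  independent-tail ind = independent λ cs lc≈ε i →
    relation-trivial ind (0 Vector.∷ cs) (trans (identityˡ _) lc≈ε) (suc i)

  -- If p divided every aᵢ, then p ^ n would annihilate lc as ws, leaving the relation
  -- p ^ n • x ≈ p ^ n • lc ds (tail bs) on bs, which is nontrivial because p ^ n ≢ 0 modulo p ^ suc n.
  some-coefficient-invertible : ∀ {k j} {bs : Vector Carrier (suc k)} {ws : Vector Carrier j} {ds as} →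
    Independent bs → head bs ≈ lc ds (tail bs) ∙ lc as ws → ∃ λ i → p ∤ as i
  some-coefficient-invertible {j = j} {bs} {ws} {ds} {as} ind x≈ with all? (λ i → p ∣? as i)
  ... | no  ¬p∣as = ¬∀⟶∃¬ j _ (λ i → p ∣? as i) ¬p∣as
  ... | yes p∣as  = contradiction p^n%m≡0 p^n%p^[1+n]≢0
    where
    x : Carrier
    x = head bs
    q : ℕ
    q = p ^ n
    p^n•x≈ : lc (q Vector.∷ λ _ → 0) bs ≈ lc (0 Vector.∷ λ i → q * ds i) bs
    p^n•x≈ = begin
      q • x ∙ lc (λ _ → 0) (tail bs)                          ≈⟨ ∙-congˡ (lc-zero (tail bs) λ _ → 0%n≡0 m) ⟩
      q • x ∙ ε                                               ≈⟨ identityʳ _ ⟩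
      q • x                                                   ≈⟨ ×-congʳ q x≈ ⟩
      q • (lc ds (tail bs) ∙ lc as ws)                        ≈⟨ ×-distrib-+ _ _ q ⟩
      q • lc ds (tail bs) ∙ q • lc as ws                      ≈⟨ ∙-cong (lc-* q ds (tail bs)) (lc-* q as ws) ⟨
      lc (λ i → q * ds i) (tail bs) ∙ lc (λ i → q * as i) ws
        ≈⟨ ∙-congˡ (lc-zero ws λ i → p∣a⇒p^n*a%p^[1+n]≡0 (p∣as i)) ⟩
      lc (λ i → q * ds i) (tail bs) ∙ ε                       ≈⟨ identityʳ _ ⟩
      lc (λ i → q * ds i) (tail bs)                           ≈⟨ identityˡ _ ⟨
      ε ∙ lc (λ i → q * ds i) (tail bs)                       ∎
    p^n%m≡0 : q % m ≡ 0
    p^n%m≡0 = ≡.trans (independent-injective ind (q Vector.∷ λ _ → 0) (0 Vector.∷ λ i → q * ds i) p^n•x≈ zero)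
                      (0%n≡0 m)

  -- x = head bs is a combination of tail bs ++ ws in which the coefficient a of wᵢ is a unit modulo
  -- p ^ suc n, so wᵢ can be traded for x.
  module Replacement {k j} (bs : Vector Carrier (suc k)) (ws : Vector Carrier (suc j))
                     (cs : Vector ℕ (k + suc j)) (i : Fin (suc j))
                     (p∤a : p ∤ cs (k ↑ʳ i)) (x≈lc : head bs ≈ lc cs (tail bs ++ ws)) where

    private
      x : Carrier
      x = head bs
      a : ℕ
      a = cs (k ↑ʳ i)
      ws′ : Vector Carrier j
      ws′ = removeAt ws i
      ds : Vector ℕ k
      ds l = cs (l ↑ˡ suc j)
      as : Vector ℕ (suc j)
      as l = cs (k ↑ʳ l)
      rest : Carrier
      rest = lc ds (tail bs) ∙ lc (removeAt as i) ws′

      x≈a•wᵢ∙rest : x ≈ a • ws i ∙ rest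
      x≈a•wᵢ∙rest = begin
        x                                                   ≈⟨ x≈lc ⟩
        lc cs (tail bs ++ ws)                               ≈⟨ lc-++ cs (tail bs) ws ⟩
        lc ds (tail bs) ∙ lc as ws                          ≈⟨ ∙-congˡ (lc-removeAt as ws i) ⟩
        lc ds (tail bs) ∙ (a • ws i ∙ lc (removeAt as i) ws′) ≈⟨ x∙yz≈y∙xz _ _ _ ⟩
        a • ws i ∙ rest                                     ∎

    spans : Spans (bs ++ ws′) (tail bs ++ ws)
    spans = spans-++ {zs = bs ++ ws′} (λ l → span-++ˡ {xs = bs} ws′ (span-member bs (suc l)))
                     (spans-removeAt i wᵢ-spanned (λ l → span-++ʳ bs (span-member ws′ l)))
      where
      rest-spanned : Span (bs ++ ws′) rest
      rest-spanned = span-∙ (span-++ˡ {xs = bs} ws′ (span-lc {xs = bs} {ys = tail bs} (λ l → span-member bs (suc l)) ds))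
                            (span-++ʳ bs (span (removeAt as i) refl))
      a•wᵢ-spanned : Span (bs ++ ws′) (a • ws i)
      a•wᵢ-spanned =
        span-cancelʳ (span-resp x≈a•wᵢ∙rest (span-++ˡ {xs = bs} ws′ (span-member bs zero))) rest-spanned
      wᵢ-spanned : Span (bs ++ ws′) (ws i)
      wᵢ-spanned with p∤a⇒invertible p∤a
      ... | u , ua≡1 = span-resp u•a•wᵢ≈wᵢ (span-• u a•wᵢ-spanned)
        where
        u•a•wᵢ≈wᵢ : u • a • ws i ≈ ws i
        u•a•wᵢ≈wᵢ = trans (×-assocˡ (ws i) u a) (trans (•-mod (ws i) ua≡1) (×-homo-1 (ws i)))

    -- Substituting the combination for x turns a relation es on bs ++ ws′ into the relation F on
    -- tail bs ++ ws, whose coefficient at wᵢ is e₀ * a; as a is a unit, e₀ vanishes, and then so does the rest.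
    relations-vanish : Independent (tail bs ++ ws) → ∀ es → lc es (bs ++ ws′) ≈ ε → ∀ l → es l % m ≡ 0
    relations-vanish ind es lc≈ε = es≡0
      where
      e₀ : ℕ
      e₀ = es zero
      eb : Vector ℕ k
      eb l = es (suc (l ↑ˡ j))
      ew : Vector ℕ j
      ew l = es (suc (k ↑ʳ l))
      others : Vector ℕ (k + suc j)
      others = eb ++ insertAt ew i 0
      F : Vector ℕ (k + suc j)
      F l = e₀ * cs l + others l

      lcF≈ε : lc F (tail bs ++ ws) ≈ ε
      lcF≈ε = begin
        lc F (tail bs ++ ws)                                              ≈⟨ lc-+ (λ l → e₀ * cs l) others _ ⟩
        lc (λ l → e₀ * cs l) (tail bs ++ ws) ∙ lc others (tail bs ++ ws)
          ≈⟨ ∙-cong (lc-* e₀ cs _) (lc-++-++ eb _ (tail bs) ws) ⟩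
        e₀ • lc cs (tail bs ++ ws) ∙ (lc eb (tail bs) ∙ lc (insertAt ew i 0) ws)
          ≈⟨ ∙-cong (×-congʳ e₀ (sym x≈lc)) (∙-congˡ (lc-insertAt-0 ew ws i)) ⟩
        e₀ • x ∙ (lc eb (tail bs) ∙ lc ew ws′)                            ≈⟨ assoc _ _ _ ⟨
        e₀ • x ∙ lc eb (tail bs) ∙ lc ew ws′                              ≈⟨ lc-++ es bs ws′ ⟨
        lc es (bs ++ ws′)                                                 ≈⟨ lc≈ε ⟩
        ε                                                                 ∎

      F≡0 : ∀ l → F l % m ≡ 0
      F≡0 = relation-trivial ind F lcF≈ε

      e₀≡0 : e₀ % m ≡ 0
      e₀≡0 = p∤a⇒cancel p∤a (≡.trans (≡.cong (_% m) F[i]≡e₀a) (F≡0 (k ↑ʳ i)))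
        where
        F[i]≡e₀a : e₀ * a ≡ F (k ↑ʳ i)
        F[i]≡e₀a = ≡.sym (≡.trans (≡.cong (e₀ * a +_) (≡.trans (lookup-++ʳ eb _ i) (insertAt-lookup ew i 0)))
                                  (+-identityʳ (e₀ * a)))

      others≡0 : ∀ l → others l % m ≡ 0
      others≡0 l = ≡.trans (≡.sym (a%m≡0⇒[a*b+c]%m≡c%m e₀ (cs l) (others l) e₀≡0)) (F≡0 l)

      es≡0 : ∀ l → es l % m ≡ 0
      es≡0 zero    = e₀≡0
      es≡0 (suc l) = ↑-elim {P = λ l → es (suc l) % m ≡ 0}
        (λ l → ≡.subst (λ t → t % m ≡ 0) (lookup-++ˡ eb _ l) (others≡0 (l ↑ˡ suc j)))
        (λ l → ≡.subst (λ t → t % m ≡ 0) (≡.trans (lookup-++ʳ eb _ (Fin.punchIn i l)) (insertAt-punchIn ew i 0 l))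
                       (others≡0 (k ↑ʳ Fin.punchIn i l)))
        l

    preserves-independence : Independent (tail bs ++ ws) → Independent (bs ++ ws′)
    preserves-independence ind = independent (relations-vanish ind)

  Completion : ∀ {k N} → Vector Carrier k → Vector Carrier N → Set
  Completion {k} {N} bs zs =
    ∃ λ j → Σ (Vector Carrier j) λ ws → k + j ≡ N × Spans (bs ++ ws) zs × (Independent zs → Independent (bs ++ ws))

  private
    exchange-step : ∀ {k j N} {zs : Vector Carrier N} (bs : Vector Carrier (suc k)) (ws : Vector Carrier j) →
      Independent bs → k + j ≡ N → Spans (tail bs ++ ws) zs → (Independent zs → Independent (tail bs ++ ws)) →
      Span (tail bs ++ ws) (head bs) → Completion bs zs
    exchange-step {k} {zero} bs ws bs-ind _ _ _ (span cs x≈lc)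
      with some-coefficient-invertible {bs = bs} {ws} {λ l → cs (l ↑ˡ zero)} {λ l → cs (k ↑ʳ l)}
             bs-ind (trans x≈lc (lc-++ cs (tail bs) ws))
    ... | () , _
    exchange-step {k} {suc j} bs ws bs-ind k+j≡N spans ind⇒ind (span cs x≈lc)
      with some-coefficient-invertible {bs = bs} {ws} {λ l → cs (l ↑ˡ suc j)} {λ l → cs (k ↑ʳ l)}
             bs-ind (trans x≈lc (lc-++ cs (tail bs) ws))
    ... | i , p∤a = j , removeAt ws i , ≡.trans (≡.sym (+-suc k j)) k+j≡N ,
                    spans-trans R.spans spans , λ zs-ind → R.preserves-independence (ind⇒ind zs-ind)
      where module R = Replacement bs ws cs i p∤a x≈lc

  exchange : ∀ {k N} (bs : Vector Carrier k) (zs : Vector Carrier N) → Independent bs → Spans zs bs → Completion bs zs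
  exchange {zero}  {N} bs zs _ _ = N , zs , ≡.refl , span-member zs , λ ind → ind
  exchange {suc k}     bs zs bs-ind zs-spans-bs
    with exchange (tail bs) zs (independent-tail bs-ind) (λ l → zs-spans-bs (suc l))
  ... | j , ws , k+j≡N , spans , ind⇒ind =
    exchange-step bs ws bs-ind k+j≡N spans ind⇒ind (span-trans spans (zs-spans-bs zero))

  independent≤spanning : ∀ {k N} {bs : Vector Carrier k} {zs : Vector Carrier N} → Independent bs → Spans zs bs → k ≤ N
  independent≤spanning {k} {bs = bs} {zs} bs-ind zs-spans-bs with exchange bs zs bs-ind zs-spans-bs
  ... | j , _ , k+j≡N , _ = ≡.subst (k ≤_) k+j≡N (m≤m+n k j)

module ZmOmegaProperties (m : ℕ) .{{_ : NonZero m}} where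
  open ZMod m public using (ZmOmega; _≈m_; negL)
  open ZMod m using (lk-neg)
  open Independence ZmOmega m
  open ≡ using (cong)
  open ≡.≡-Reasoning

  lk-• : ∀ c xs i → lk (c • xs) i ≡ c * lk xs i
  lk-• zero    xs i = ≡.refl
  lk-• (suc c) xs i = ≡.trans (lk-add xs (c • xs) i) (cong (lk xs i +_) (lk-• c xs i))

  isAbelianGroupOfExponent : IsAbelianGroupOfExponent ZmOmega m
  isAbelianGroupOfExponent = record
    { assoc     = λ xs ys zs i → cong (_% m) (begin
        lk (addL (addL xs ys) zs) i       ≡⟨ lk-add (addL xs ys) zs i ⟩
        lk (addL xs ys) i + lk zs i       ≡⟨ cong (_+ lk zs i) (lk-add xs ys i) ⟩
        lk xs i + lk ys i + lk zs i       ≡⟨ +-assoc (lk xs i) (lk ys i) (lk zs i) ⟩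
        lk xs i + (lk ys i + lk zs i)     ≡⟨ cong (lk xs i +_) (lk-add ys zs i) ⟨
        lk xs i + lk (addL ys zs) i       ≡⟨ lk-add xs (addL ys zs) i ⟨
        lk (addL xs (addL ys zs)) i       ∎)
    ; comm      = λ xs ys i → cong (_% m) (≡.trans (lk-add xs ys i)
                                (≡.trans (+-comm (lk xs i) (lk ys i)) (≡.sym (lk-add ys xs i))))
    ; identityˡ = λ xs i → ≡.refl
    ; inverseˡ  = inverseˡ
    ; exponent  = λ xs i → ≡.trans (cong (_% m) (≡.trans (lk-• m xs i) (*-comm m (lk xs i))))
                                   (≡.trans (m*n%n≡0 (lk xs i) m) (≡.sym (0%n≡0 m)))
    }
    where
    inverseˡ : ∀ xs i → lk (addL (negL xs) xs) i % m ≡ lk [] i % m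
    inverseˡ xs i = begin
      lk (addL (negL xs) xs) i % m                 ≡⟨ cong (_% m) (lk-add (negL xs) xs i) ⟩
      (lk (negL xs) i + lk xs i) % m               ≡⟨ %-distribˡ-+ (lk (negL xs) i) (lk xs i) m ⟩
      (lk (negL xs) i % m + lk xs i % m) % m
        ≡⟨ cong₂ (λ s t → (s + t) % m) (lk-neg xs i) (≡.sym (m%n%n≡m%n (lk xs i) m)) ⟩
      ((m ∸ a) % m + a % m) % m                    ≡⟨ %-distribˡ-+ (m ∸ a) a m ⟨
      (m ∸ a + a) % m                              ≡⟨ cong (_% m) (m∸n+n≡m (m%n≤n (lk xs i) m)) ⟩
      m % m                                        ≡⟨ n%n≡0 m ⟩
      0                                            ≡⟨ 0%n≡0 m ⟨
      0 % m                                        ∎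
      where
      a : ℕ
      a = lk xs i % m

  unit : ℕ → List ℕ
  unit zero    = 1 ∷ []
  unit (suc i) = 0 ∷ unit i

  units : ∀ k → Vector (List ℕ) k
  units k j = unit (toℕ j)

  lk-lc-shift : ∀ {k} (cs : Vector ℕ k) (xss : Vector (List ℕ) k) i →
                lk (lc cs (λ j → 0 ∷ xss j)) i ≡ lk (0 ∷ lc cs xss) i
  lk-lc-shift {zero}  cs xss zero    = ≡.refl
  lk-lc-shift {zero}  cs xss (suc i) = ≡.refl
  lk-lc-shift {suc k} cs xss i       = begin
    lk (addL (cs zero • (0 ∷ xss zero)) (lc (tail cs) (λ j → 0 ∷ xss (suc j)))) i
      ≡⟨ lk-add (cs zero • (0 ∷ xss zero)) _ i ⟩
    lk (cs zero • (0 ∷ xss zero)) i + lk (lc (tail cs) (λ j → 0 ∷ xss (suc j))) i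
      ≡⟨ cong₂ _+_ (lk-• (cs zero) (0 ∷ xss zero) i) (lk-lc-shift (tail cs) (tail xss) i) ⟩
    cs zero * lk (0 ∷ xss zero) i + lk (0 ∷ lc (tail cs) (tail xss)) i
      ≡⟨ shifted i ⟩
    lk (0 ∷ lc cs xss) i ∎
    where
    shifted : ∀ i → cs zero * lk (0 ∷ xss zero) i + lk (0 ∷ lc (tail cs) (tail xss)) i ≡ lk (0 ∷ lc cs xss) i
    shifted zero    = cong (_+ 0) (*-zeroʳ (cs zero))
    shifted (suc i) = ≡.sym (≡.trans (lk-add (cs zero • xss zero) _ i)
                                     (cong (_+ lk (lc (tail cs) (tail xss)) i) (lk-• (cs zero) (xss zero) i)))

  lk-lc-units : ∀ {k} (cs : Vector ℕ k) i → lk (lc cs (units k)) i ≡ lk (toList cs) i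
  lk-lc-units {zero}  cs i = ≡.refl
  lk-lc-units {suc k} cs i = begin
    lk (addL (cs zero • unit 0) (lc (tail cs) (λ j → 0 ∷ units k j))) i
      ≡⟨ lk-add (cs zero • unit 0) _ i ⟩
    lk (cs zero • unit 0) i + lk (lc (tail cs) (λ j → 0 ∷ units k j)) i
      ≡⟨ cong₂ _+_ (lk-• (cs zero) (unit 0) i) (lk-lc-shift (tail cs) (units k) i) ⟩
    cs zero * lk (unit 0) i + lk (0 ∷ lc (tail cs) (units k)) i
      ≡⟨ at i ⟩
    lk (toList cs) i ∎
    where
    at : ∀ i → cs zero * lk (unit 0) i + lk (0 ∷ lc (tail cs) (units k)) i ≡ lk (toList cs) i
    at zero    = ≡.trans (+-identityʳ _) (*-identityʳ (cs zero))
    at (suc i) = ≡.trans (cong (_+ lk (lc (tail cs) (units k)) i) (*-zeroʳ (cs zero))) (lk-lc-units (tail cs) i)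

  units-independent : ∀ k → Independent (units k)
  units-independent k = independent λ cs lc≈[] j →
    ≡.trans (cong (_% m) (≡.sym (≡.trans (lk-lc-units cs (toℕ j)) (lk-toList cs j))))
            (≡.trans (lc≈[] (toℕ j)) (0%n≡0 m))

  lc-coordinates : ∀ K xs → lc (coordinates K xs) (units K) ≈m take K xs
  lc-coordinates K xs i = cong (_% m) (≡.trans (lk-lc-units (coordinates K xs) i) (lk-toList-coordinates K xs i))

  take-≈m : ∀ K {xs ys} → (∀ i → i < K → lk xs i % m ≡ lk ys i % m) → (∀ i → K ≤ i → lk ys i % m ≡ 0) →
            take K xs ≈m ys
  take-≈m K {xs} agree vanish i with i <? K
  ... | yes i<K = ≡.trans (cong (_% m) (lk-take-< K xs i<K)) (agree i i<K)
  ... | no  i≮K =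
    ≡.trans (cong (_% m) (lk-take-≥ K xs (≮⇒≥ i≮K))) (≡.trans (0%n≡0 m) (≡.sym (vanish i (≮⇒≥ i≮K))))

  take-cong : ∀ K {xs ys} → xs ≈m ys → take K xs ≈m take K ys
  take-cong K {xs} {ys} xs≈ys = take-≈m K {xs} {take K ys}
    (λ i i<K → ≡.trans (xs≈ys i) (cong (_% m) (≡.sym (lk-take-< K ys i<K))))
    (λ i K≤i → ≡.trans (cong (_% m) (lk-take-≥ K ys K≤i)) (0%n≡0 m))

  take-addL : ∀ K xs ys → take K (addL xs ys) ≈m addL (take K xs) (take K ys)
  take-addL K xs ys = take-≈m K {addL xs ys} {addL (take K xs) (take K ys)}
    (λ i i<K → cong (_% m) (≡.trans (lk-add xs ys i)
                 (≡.sym (≡.trans (lk-add (take K xs) (take K ys) i) (cong₂ _+_ (lk-take-< K xs i<K) (lk-take-< K ys i<K))))))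
    (λ i K≤i → ≡.trans (cong (_% m) (≡.trans (lk-add (take K xs) (take K ys) i)
                                       (cong₂ _+_ (lk-take-≥ K xs K≤i) (lk-take-≥ K ys K≤i))))
                       (0%n≡0 m))

  take-negL : ∀ K xs → take K (negL xs) ≈m negL (take K xs)
  take-negL K xs = take-≈m K {negL xs} {negL (take K xs)}
    (λ i i<K → ≡.trans (lk-neg xs i)
                 (≡.sym (≡.trans (lk-neg (take K xs) i) (cong (λ a → (m ∸ a % m) % m) (lk-take-< K xs i<K)))))
    (λ i K≤i → begin
      lk (negL (take K xs)) i % m      ≡⟨ lk-neg (take K xs) i ⟩
      (m ∸ lk (take K xs) i % m) % m   ≡⟨ cong (λ a → (m ∸ a % m) % m) (lk-take-≥ K xs K≤i) ⟩
      (m ∸ 0 % m) % m                  ≡⟨ cong (λ a → (m ∸ a) % m) (0%n≡0 m) ⟩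
      m % m                            ≡⟨ n%n≡0 m ⟩
      0                                ∎)

  truncation : ℕ → Endomorphism ZmOmega
  truncation K = record
    { h      = take K
    ; h-cong = take-cong K
    ; h-∙    = take-addL K
    ; h-⁻¹   = take-negL K
    ; h-ε    = take-≈m K {[]} {[]} (λ _ _ → ≡.refl) (λ _ _ → 0%n≡0 m)
    }

  countable : Countable ZmOmega
  countable = countable-by {ZmOmega} decode decode-surjective

  independently-spanned : IndependentlySpanned
  independently-spanned r xss =
    Σlength xss , units K , units-independent K , λ t → span (coordinates K (xss t)) (xₜ≈lc t)
    where
    K : ℕ
    K = Σlength xss + r
    xₜ≈lc : ∀ t → xss t ≈m lc (coordinates K (xss t)) (units K)
    xₜ≈lc t i = ≡.trans (cong (λ ys → lk ys i % m) (≡.sym (take-all K (xss t) xₜ-short)))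
                        (≡.sym (lc-coordinates K (xss t) i))
      where
      xₜ-short : length (xss t) ≤ K
      xₜ-short = ≤-trans (length≤Σlength xss t) (m≤m+n _ r)

-- Countable models with independent spans

module BasisIsomorphism {M : Str} {m : ℕ} .{{_ : NonZero m}} (G : IsAbelianGroupOfExponent M m)
                        (b : ℕ → Str.Carrier M)
                        (b-independent : ∀ N → Independence.Independent M m (prefix N b))
                        (b-spans : ∀ x → ∃ λ N → Combination.Span M (prefix N b) x) where
  open Linear G
  open ZmOmegaProperties m using (ZmOmega; _≈m_; negL; isAbelianGroupOfExponent)
  open IsAbelianGroupOfExponent isAbelianGroupOfExponent using () renaming (inverseˡ to ZmOmega-inverseˡ)
  open GroupProperties group using (inverseˡ-unique)
  open SetoidReasoning setoid

  g : List ℕ → Carrier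
  g xs = lc (prefix (length xs) (lk xs)) (prefix (length xs) b)

  private
    vanishes-beyond : ∀ {K} xs → length xs ≤ K → ∀ i → K ≤ i → lk xs i % m ≡ 0
    vanishes-beyond xs len≤K i K≤i = ≡.trans (≡.cong (_% m) (lk-≥length xs (≤-trans len≤K K≤i))) (0%n≡0 m)

    g-prefix : ∀ K xs → (∀ i → K ≤ i → lk xs i % m ≡ 0) → g xs ≈ lc (prefix K (lk xs)) (prefix K b)
    g-prefix K xs xs≡0 = lc-prefix-stable (lk xs) b (vanishes-beyond xs ≤-refl) xs≡0

  g-cong : ∀ {xs ys} → xs ≈m ys → g xs ≈ g ys
  g-cong {xs} {ys} xs≈ys = begin
    g xs                                ≈⟨ g-prefix K xs (vanishes-beyond xs (m≤m+n _ _)) ⟩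
    lc (prefix K (lk xs)) (prefix K b)  ≈⟨ lc-congˡ (prefix K b) (λ j → xs≈ys (toℕ j)) ⟩
    lc (prefix K (lk ys)) (prefix K b)  ≈⟨ g-prefix K ys (vanishes-beyond ys (m≤n+m _ _)) ⟨
    g ys                                ∎
    where
    K : ℕ
    K = length xs + length ys

  g-∙ : ∀ xs ys → g (addL xs ys) ≈ g xs ∙ g ys
  g-∙ xs ys = begin
    g (addL xs ys)                                          ≈⟨ g-prefix K (addL xs ys) sum≡0 ⟩
    lc (prefix K (lk (addL xs ys))) (prefix K b)
      ≈⟨ lc-congˡ (prefix K b) (λ j → ≡.cong (_% m) (lk-add xs ys (toℕ j))) ⟩
    lc (λ j → lk xs (toℕ j) + lk ys (toℕ j)) (prefix K b)
      ≈⟨ lc-+ (prefix K (lk xs)) (prefix K (lk ys)) (prefix K b) ⟩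
    lc (prefix K (lk xs)) (prefix K b) ∙ lc (prefix K (lk ys)) (prefix K b)
      ≈⟨ ∙-cong (g-prefix K xs (vanishes-beyond xs (m≤m+n _ _))) (g-prefix K ys (vanishes-beyond ys (m≤n+m _ _))) ⟨
    g xs ∙ g ys                                             ∎
    where
    K : ℕ
    K = length xs + length ys
    sum≡0 : ∀ i → K ≤ i → lk (addL xs ys) i % m ≡ 0
    sum≡0 i K≤i = ≡.trans (≡.cong (_% m) (≡.trans (lk-add xs ys i)
                    (cong₂ _+_ (lk-≥length xs (≤-trans (m≤m+n _ _) K≤i)) (lk-≥length ys (≤-trans (m≤n+m _ _) K≤i)))))
                  (0%n≡0 m)

  g-injective : ∀ {xs ys} → g xs ≈ g ys → xs ≈m ys
  g-injective {xs} {ys} gxs≈gys = coordinatewise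
    where
    K : ℕ
    K = length xs + length ys
    coordinates-agree : ∀ j → lk xs (toℕ j) % m ≡ lk ys (toℕ j) % m
    coordinates-agree = independent-injective (b-independent K) (prefix K (lk xs)) (prefix K (lk ys))
      (trans (sym (g-prefix K xs (vanishes-beyond xs (m≤m+n _ _))))
             (trans gxs≈gys (g-prefix K ys (vanishes-beyond ys (m≤n+m _ _)))))
    coordinatewise : ∀ i → lk xs i % m ≡ lk ys i % m
    coordinatewise i with i <? K
    ... | yes i<K = ≡.subst (λ i → lk xs i % m ≡ lk ys i % m) (toℕ-fromℕ< i<K) (coordinates-agree (fromℕ< i<K))
    ... | no  i≮K = ≡.trans (vanishes-beyond xs (m≤m+n _ _) i (≮⇒≥ i≮K))
                            (≡.sym (vanishes-beyond ys (m≤n+m _ _) i (≮⇒≥ i≮K)))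

  g-⁻¹ : ∀ xs → g (negL xs) ≈ g xs ⁻¹
  g-⁻¹ xs = inverseˡ-unique (g (negL xs)) (g xs)
    (trans (sym (g-∙ (negL xs) xs)) (g-cong {addL (negL xs) xs} {[]} (ZmOmega-inverseˡ xs)))

  g-surjective : ∀ y → ∃ λ xs → g xs ≈ y
  g-surjective y with b-spans y
  ... | N , span cs y≈lc = toList cs , (begin
    g (toList cs)
      ≈⟨ g-prefix N (toList cs) (vanishes-beyond (toList cs) (≤-reflexive (length-tabulate cs))) ⟩
    lc (prefix N (lk (toList cs))) (prefix N b)  ≈⟨ lc-congˡ (prefix N b) (λ j → ≡.cong (_% m) (lk-toList cs j)) ⟩
    lc cs (prefix N b)                          ≈⟨ y≈lc ⟨
    y                                           ∎)

  ZmOmega≅ : ZmOmega ≅ M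
  ZmOmega≅ = record
    { f = g ; f-cong = λ {xs} {ys} → g-cong {xs} {ys} ; f-inj = λ {xs} {ys} → g-injective {xs} {ys} ; f-surj = g-surjective
    ; f-∙ = g-∙ ; f-⁻¹ = g-⁻¹ ; f-ε = refl }

module Classification {M : Str} {p : ℕ} (p-prime : Prime p) (n : ℕ) .{{_ : NonZero (p ^ suc n)}}
                      (G : IsAbelianGroupOfExponent M (p ^ suc n))
                      (independently-spanned : Independence.IndependentlySpanned M (p ^ suc n))
                      (countable : Countable M) where
  open Linear G
  open Exchange p-prime n G using (exchange)

  private
    enum : ℕ → Carrier
    enum = proj₁ countable

  record Extension {d} (bs : Vector Carrier d) (x : Carrier) : Set where
    field
      {size}               : ℕ
      extra                : Vector Carrier size
      grows                : suc d ≤ d + size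
      extended-independent : Independent (bs ++ extra)
      extended-spans       : Span (bs ++ extra) x

  -- Apply the hypothesis to x ∷ bs, then exchange so that bs stays an initial segment.
  extend : ∀ {d} (bs : Vector Carrier d) → Independent bs → ∀ x → Extension bs x
  extend {d} bs bs-ind x with independently-spanned (suc d) (x Vector.∷ bs)
  ... | j , zs , zs-ind , zs-spans with exchange bs zs bs-ind (λ i → zs-spans (suc i))
  ... | _ , ws , d+j′≡j+[1+d] , ws-spans , ind⇒ind = record
    { extra                = ws
    ; grows                = ≡.subst (suc d ≤_) (≡.sym d+j′≡j+[1+d]) (m≤n+m (suc d) j)
    ; extended-independent = ind⇒ind zs-ind
    ; extended-spans       = span-trans ws-spans (zs-spans zero)
    }

  record Stage (t : ℕ) : Set where
    field
      dim               : ℕ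
      basis             : Vector Carrier dim
      basis-independent : Independent basis
      basis-spans       : ∀ i → i < t → Span basis (enum i)
      t≤dim             : t ≤ dim
  open Stage

  next : ∀ {t} → Stage t → Stage (suc t)
  next {t} s = record
    { dim               = dim s + Extension.size ext
    ; basis             = basis s ++ Extension.extra ext
    ; basis-independent = Extension.extended-independent ext
    ; basis-spans       = spans
    ; t≤dim             = ≤-trans (s≤s (t≤dim s)) (Extension.grows ext)
    }
    where
    ext : Extension (basis s) (enum t)
    ext = extend (basis s) (basis-independent s) (enum t)
    spans : ∀ i → i < suc t → Span (basis s ++ Extension.extra ext) (enum i)
    spans i (s≤s i≤t) with m≤n⇒m<n∨m≡n i≤t
    ... | inj₁ i<t    = span-++ˡ (Extension.extra ext) (basis-spans s i i<t)
    ... | inj₂ ≡.refl = Extension.extended-spans ext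

  stage : ∀ t → Stage t
  stage zero    = record
    { dim = 0 ; basis = λ () ; basis-independent = independent λ _ _ () ; basis-spans = λ _ () ; t≤dim = z≤n }
  stage (suc t) = next (stage t)

  dim-mono : ∀ {t t′} → t ≤′ t′ → dim (stage t) ≤ dim (stage t′)
  dim-mono ≤′-refl       = ≤-refl
  dim-mono (≤′-step t≤t′) = ≤-trans (dim-mono t≤t′) (m≤m+n _ _)

  coherent : ∀ {t t′} → t ≤′ t′ → ∀ j j′ → toℕ j ≡ toℕ j′ → basis (stage t′) j′ ≡ basis (stage t) j
  coherent {t} ≤′-refl            j j′ j≡j′ = ≡.cong (basis (stage t)) (toℕ-injective (≡.sym j≡j′))
  coherent {t} (≤′-step {t′} t≤t′) j j′ j≡j′ =
    ≡.trans (lookup-++-< (basis (stage t′)) _ j′ j′<dim)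
            (coherent t≤t′ j (fromℕ< j′<dim) (≡.trans j≡j′ (≡.sym (toℕ-fromℕ< j′<dim))))
    where
    j′<dim : toℕ j′ < dim (stage t′)
    j′<dim = ≡.subst (_< dim (stage t′)) j≡j′ (≤-trans (toℕ<n j) (dim-mono t≤t′))

  b : ℕ → Carrier
  b i = basis (stage (suc i)) (fromℕ< (t≤dim (stage (suc i))))

  basis≡prefix : ∀ t j → basis (stage t) j ≡ b (toℕ j)
  basis≡prefix t j with ≤-total t (suc (toℕ j))
  ... | inj₁ t≤ = ≡.sym (coherent (≤⇒≤′ t≤) j _ (≡.sym (toℕ-fromℕ< _)))
  ... | inj₂ ≤t = coherent (≤⇒≤′ ≤t) _ j (toℕ-fromℕ< _)

  b-independent : ∀ N → Independent (prefix N b)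
  b-independent N = independent-prefix {b = b} (t≤dim (stage N))
    (independent-respʳ (λ j → reflexive (basis≡prefix N j)) (basis-independent (stage N)))

  b-spans : ∀ x → ∃ λ N → Span (prefix N b) x
  b-spans x with proj₂ countable x
  ... | i , enum-i≈x = dim (stage (suc i)) ,
    span-resp enum-i≈x (span-respʳ (λ j → reflexive (basis≡prefix (suc i) j)) (basis-spans (stage (suc i)) i ≤-refl))

  ≅ZmOmega : M ≅ ZMod.ZmOmega (p ^ suc n)
  ≅ZmOmega = ≅-sym (BasisIsomorphism.ZmOmega≅ G b b-independent b-spans)

-- The Π₂ Scott sentence

⊤ᶠ : ∀ {n} → QF n
⊤ᶠ = e ≐ e

⌜_⌝ : ∀ {n} {P : Set} → Dec P → QF n
⌜ yes _ ⌝ = ⊤ᶠ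
⌜ no  _ ⌝ = ¬ᶠ ⊤ᶠ

⋀< : ∀ {n} → ℕ → (ℕ → QF n) → QF n
⋀< zero    F = ⊤ᶠ
⋀< (suc c) F = ⋀< c F ∧ᶠ F c

⋁< : ∀ {n} → ℕ → (ℕ → QF n) → QF n
⋁< zero    F = ¬ᶠ ⊤ᶠ
⋁< (suc c) F = ⋁< c F ∨ᶠ F c

⋀Fin : ∀ {n} r → (Fin r → QF n) → QF n
⋀Fin zero    F = ⊤ᶠ
⋀Fin (suc r) F = F zero ∧ᶠ ⋀Fin r (λ t → F (suc t))

⋀Tuples : ∀ {n} m k → (Vec ℕ k → QF n) → QF n
⋀Tuples m zero    F = F []
⋀Tuples m (suc k) F = ⋀< m λ c → ⋀Tuples m k (λ cs → F (c ∷ cs))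

⋁Tuples : ∀ {n} m k → (Vec ℕ k → QF n) → QF n
⋁Tuples m zero    F = F []
⋁Tuples m (suc k) F = ⋁< m λ c → ⋁Tuples m k (λ cs → F (c ∷ cs))

mulᵗ : ∀ {n} → ℕ → Term n → Term n
mulᵗ zero    t = e
mulᵗ (suc c) t = t · mulᵗ c t

lcᵗ : ∀ {n k} → Vec ℕ k → Vector (Term n) k → Term n
lcᵗ []       ts = e
lcᵗ (c ∷ cs) ts = mulᵗ c (head ts) · lcᵗ cs (tail ts)

module Satisfaction (M : Str) where
  open Str M
  open Combination M
  private module E = IsEquivalence isEquiv

  ⟦mulᵗ⟧ : ∀ {n} c (t : Term n) ρ → ⟦ M ⟧t (mulᵗ c t) ρ ≡ c • ⟦ M ⟧t t ρ
  ⟦mulᵗ⟧ zero    t ρ = ≡.refl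
  ⟦mulᵗ⟧ (suc c) t ρ = ≡.cong (⟦ M ⟧t t ρ ∙_) (⟦mulᵗ⟧ c t ρ)

  ⟦lcᵗ⟧ : ∀ {n k} (cs : Vec ℕ k) {ts : Vector (Term n) k} {ρ xs} → (∀ i → ⟦ M ⟧t (ts i) ρ ≡ xs i) →
          ⟦ M ⟧t (lcᵗ cs ts) ρ ≡ lc (lookup cs) xs
  ⟦lcᵗ⟧ []       ts≡xs = ≡.refl
  ⟦lcᵗ⟧ (c ∷ cs) {ts} {ρ} ts≡xs =
    cong₂ _∙_ (≡.trans (⟦mulᵗ⟧ c (ts zero) ρ) (≡.cong (c •_) (ts≡xs zero))) (⟦lcᵗ⟧ cs (λ i → ts≡xs (suc i)))

  ⌜⌝⁺ : ∀ {n} {P : Set} {ρ : Vector Carrier n} (P? : Dec P) → P → satQF M ⌜ P? ⌝ ρ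
  ⌜⌝⁺ (yes _) _ = E.refl
  ⌜⌝⁺ (no ¬p) p = contradiction p ¬p

  ⌜⌝⁻ : ∀ {n} {P : Set} {ρ : Vector Carrier n} (P? : Dec P) → satQF M ⌜ P? ⌝ ρ → P
  ⌜⌝⁻ (yes p) _   = p
  ⌜⌝⁻ (no  _) sat = contradiction E.refl sat

  ⋀<⁺ : ∀ {n} c (F : ℕ → QF n) {ρ} → (∀ a → a < c → satQF M (F a) ρ) → satQF M (⋀< c F) ρ
  ⋀<⁺ zero    F sat = E.refl
  ⋀<⁺ (suc c) F sat = ⋀<⁺ c F (λ a a<c → sat a (m<n⇒m<1+n a<c)) , sat c ≤-refl

  ⋀<⁻ : ∀ {n} c (F : ℕ → QF n) {ρ} → satQF M (⋀< c F) ρ → ∀ a → a < c → satQF M (F a) ρ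
  ⋀<⁻ (suc c) F (sat , satc) a (s≤s a≤c) with m≤n⇒m<n∨m≡n a≤c
  ... | inj₁ a<c    = ⋀<⁻ c F sat a a<c
  ... | inj₂ ≡.refl = satc

  ⋁<⁺ : ∀ {n} c (F : ℕ → QF n) {ρ} a → a < c → satQF M (F a) ρ → satQF M (⋁< c F) ρ
  ⋁<⁺ (suc c) F a (s≤s a≤c) sat with m≤n⇒m<n∨m≡n a≤c
  ... | inj₁ a<c    = inj₁ (⋁<⁺ c F a a<c sat)
  ... | inj₂ ≡.refl = inj₂ sat

  ⋁<⁻ : ∀ {n} c (F : ℕ → QF n) {ρ} → satQF M (⋁< c F) ρ → ∃ λ a → a < c × satQF M (F a) ρ
  ⋁<⁻ zero    F sat        = contradiction E.refl sat
  ⋁<⁻ (suc c) F (inj₁ sat) = let a , a<c , satₐ = ⋁<⁻ c F sat in a , m<n⇒m<1+n a<c , satₐ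
  ⋁<⁻ (suc c) F (inj₂ sat) = c , ≤-refl , sat

  ⋀Fin⁺ : ∀ {n} r (F : Fin r → QF n) {ρ} → (∀ t → satQF M (F t) ρ) → satQF M (⋀Fin r F) ρ
  ⋀Fin⁺ zero    F sat = E.refl
  ⋀Fin⁺ (suc r) F sat = sat zero , ⋀Fin⁺ r (λ t → F (suc t)) (λ t → sat (suc t))

  ⋀Fin⁻ : ∀ {n} r (F : Fin r → QF n) {ρ} → satQF M (⋀Fin r F) ρ → ∀ t → satQF M (F t) ρ
  ⋀Fin⁻ (suc r) F (sat₀ , sat) zero    = sat₀
  ⋀Fin⁻ (suc r) F (sat₀ , sat) (suc t) = ⋀Fin⁻ r (λ t → F (suc t)) sat t

  ⋀Tuples⁺ : ∀ {n} m k (F : Vec ℕ k → QF n) {ρ} →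
             (∀ cs → All (_< m) cs → satQF M (F cs) ρ) → satQF M (⋀Tuples m k F) ρ
  ⋀Tuples⁺ m zero    F sat = sat [] []
  ⋀Tuples⁺ m (suc k) F sat =
    ⋀<⁺ m _ λ c c<m → ⋀Tuples⁺ m k (λ cs → F (c ∷ cs)) λ cs cs<m → sat (c ∷ cs) (c<m ∷ cs<m)

  ⋀Tuples⁻ : ∀ {n} m k (F : Vec ℕ k → QF n) {ρ} →
             satQF M (⋀Tuples m k F) ρ → ∀ cs → All (_< m) cs → satQF M (F cs) ρ
  ⋀Tuples⁻ m zero    F sat []       []           = sat
  ⋀Tuples⁻ m (suc k) F sat (c ∷ cs) (c<m ∷ cs<m) = ⋀Tuples⁻ m k (λ cs → F (c ∷ cs)) (⋀<⁻ m _ sat c c<m) cs cs<m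

  ⋁Tuples⁺ : ∀ {n} m k (F : Vec ℕ k → QF n) {ρ} cs →
             All (_< m) cs → satQF M (F cs) ρ → satQF M (⋁Tuples m k F) ρ
  ⋁Tuples⁺ m zero    F []       []           sat = sat
  ⋁Tuples⁺ m (suc k) F (c ∷ cs) (c<m ∷ cs<m) sat = ⋁<⁺ m _ c c<m (⋁Tuples⁺ m k (λ cs → F (c ∷ cs)) cs cs<m sat)

  ⋁Tuples⁻ : ∀ {n} m k (F : Vec ℕ k → QF n) {ρ} →
             satQF M (⋁Tuples m k F) ρ → ∃ λ cs → All (_< m) cs × satQF M (F cs) ρ
  ⋁Tuples⁻ m zero    F sat = [] , [] , sat
  ⋁Tuples⁻ m (suc k) F sat with ⋁<⁻ m _ sat
  ... | c , c<m , satc with ⋁Tuples⁻ m k (λ cs → F (c ∷ cs)) satc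
  ... | cs , cs<m , satcs = c ∷ cs , c<m ∷ cs<m , satcs

module ScottSentence (m : ℕ) where

  independentᶠ : ∀ {n k} → Vector (Term n) k → QF n
  independentᶠ {k = k} ts = ⋀Tuples m k λ cs → (¬ᶠ (lcᵗ cs ts ≐ e)) ∨ᶠ ⌜ All.all? (_≟ 0) cs ⌝

  spanᶠ : ∀ {n k} → Vector (Term n) k → Term n → QF n
  spanᶠ {k = k} ts t = ⋁Tuples m k λ cs → t ≐ lcᵗ cs ts

  -- Coefficients range
  -- over [0, m), so both conjuncts are finitary; the zs are the first j + r variables of the context.
  independently-spannedᶠ : ∀ r → Σf 1 (r + 0)
  independently-spannedᶠ r j = j + r , (independentᶠ zs ∧ᶠ ⋀Fin r λ t → spanᶠ zs (xs t))
    where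
    zs : Vector (Term ((j + r) + (r + 0))) (j + r)
    zs i = var (i ↑ˡ (r + 0))
    xs : Vector (Term ((j + r) + (r + 0))) r
    xs t = var ((j + r) ↑ʳ (t ↑ˡ 0))

  axiom : ∀ {k} → QF (k + 0) → Σf 1 (k + 0)
  axiom φ _ = 0 , φ

  x₀ : ∀ {n} → Term (1 + n)
  x₀ = var zero
  x₁ : ∀ {n} → Term (2 + n)
  x₁ = var (suc zero)
  x₂ : ∀ {n} → Term (3 + n)
  x₂ = var (suc (suc zero))

  φ : Π-sentence 2
  φ 0 = 3 , axiom (((x₀ · x₁) · x₂) ≐ (x₀ · (x₁ · x₂)))
  φ 1 = 2 , axiom ((x₀ · x₁) ≐ (x₁ · x₀))
  φ 2 = 1 , axiom ((e · x₀) ≐ x₀)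
  φ 3 = 1 , axiom ((inv x₀ · x₀) ≐ e)
  φ 4 = 1 , axiom (mulᵗ m x₀ ≐ e)
  φ (suc (suc (suc (suc (suc r))))) = r , independently-spannedᶠ r

module ScottSentenceSemantics (M : Str) (m : ℕ) .{{_ : NonZero m}} where
  open Str M
  open Independence M m
  open Satisfaction M
  open ScottSentence m
  private module E = IsEquivalence isEquiv

  private
    module _ {j r} (zs : Vector Carrier (j + r)) (xs : Vector Carrier r) (ρ : Vector Carrier 0) where
      σ : Vector Carrier ((j + r) + (r + 0))
      σ = zs ++ (xs ++ ρ)

      ⟦lcᵗ-zs⟧ : ∀ cs → ⟦ M ⟧t (lcᵗ cs (λ i → var (i ↑ˡ (r + 0)))) σ ≡ lc (lookup cs) zs
      ⟦lcᵗ-zs⟧ cs = ⟦lcᵗ⟧ cs (λ i → lookup-++ˡ zs (xs ++ ρ) i)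

      ⟦xs⟧ : ∀ t → ⟦ M ⟧t (var ((j + r) ↑ʳ (t ↑ˡ 0))) σ ≡ xs t
      ⟦xs⟧ t = ≡.trans (lookup-++ʳ zs (xs ++ ρ) (t ↑ˡ 0)) (lookup-++ˡ xs ρ t)

  independently-spannedᶠ⁺ : ∀ {r} (xs : Vector Carrier r) {ρ} j (zs : Vector Carrier (j + r)) →
    ReducedIndependent zs → (∀ t → ReducedSpan zs (xs t)) → satΣ M 1 (independently-spannedᶠ r) (xs ++ ρ)
  independently-spannedᶠ⁺ {r} xs {ρ} j zs zs-independent zs-spans = j , zs , independence , spans
    where
    zsᵗ : Vector (Term ((j + r) + (r + 0))) (j + r)
    zsᵗ i = var (i ↑ˡ (r + 0))
    independence : satQF M (independentᶠ zsᵗ) (zs ++ (xs ++ ρ))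
    independence = ⋀Tuples⁺ m (j + r) _ λ cs cs<m → case All.all? (_≟ 0) cs of λ where
      (yes cs≡0) → inj₂ (⌜⌝⁺ (All.all? (_≟ 0) cs) cs≡0)
      (no cs≢0)  → inj₁ λ lc≈ε → cs≢0 (zs-independent cs cs<m (≡.subst (_≈ ε) (⟦lcᵗ-zs⟧ zs xs ρ cs) lc≈ε))
    spans : satQF M (⋀Fin r λ t → spanᶠ zsᵗ (var ((j + r) ↑ʳ (t ↑ˡ 0)))) (zs ++ (xs ++ ρ))
    spans = ⋀Fin⁺ r _ λ t → let cs , cs<m , xₜ≈lc = zs-spans t in
      ⋁Tuples⁺ m (j + r) _ cs cs<m (≡.subst₂ _≈_ (≡.sym (⟦xs⟧ zs xs ρ t)) (≡.sym (⟦lcᵗ-zs⟧ zs xs ρ cs)) xₜ≈lc)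

  independently-spannedᶠ⁻ : ∀ {r} (xs : Vector Carrier r) {ρ} → satΣ M 1 (independently-spannedᶠ r) (xs ++ ρ) →
    ∃ λ j → Σ (Vector Carrier (j + r)) λ zs → ReducedIndependent zs × (∀ t → ReducedSpan zs (xs t))
  independently-spannedᶠ⁻ {r} xs {ρ} (j , zs , independence , spans) = j , zs , zs-independent , zs-spans
    where
    zs-independent : ReducedIndependent zs
    zs-independent cs cs<m lc≈ε with ⋀Tuples⁻ m (j + r) _ independence cs cs<m
    ... | inj₁ lc≉ε  = contradiction (≡.subst (_≈ ε) (≡.sym (⟦lcᵗ-zs⟧ zs xs ρ cs)) lc≈ε) lc≉ε
    ... | inj₂ cs≡0 = ⌜⌝⁻ (All.all? (_≟ 0) cs) cs≡0
    zs-spans : ∀ t → ReducedSpan zs (xs t)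
    zs-spans t with ⋁Tuples⁻ m (j + r) _ (⋀Fin⁻ r _ spans t)
    ... | cs , cs<m , xₜ≈lc = cs , cs<m , ≡.subst₂ _≈_ (⟦xs⟧ zs xs ρ t) (⟦lcᵗ-zs⟧ zs xs ρ cs) xₜ≈lc

  ⊨φ⇒structure : ∀ {ρ} → satΠ M 2 φ ρ → IsAbelianGroupOfExponent M m × IndependentlySpanned
  ⊨φ⇒structure sat = G , independently-spanned
    where
    G : IsAbelianGroupOfExponent M m
    G = record
      { assoc     = λ x y z → proj₂ (proj₂ (sat 0 (x Vector.∷ y Vector.∷ z Vector.∷ Vector.[])))
      ; comm      = λ x y → proj₂ (proj₂ (sat 1 (x Vector.∷ y Vector.∷ Vector.[])))
      ; identityˡ = λ x → proj₂ (proj₂ (sat 2 (λ _ → x)))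
      ; inverseˡ  = λ x → proj₂ (proj₂ (sat 3 (λ _ → x)))
      ; exponent  = λ x → ≡.subst (_≈ ε) (⟦mulᵗ⟧ m (var zero) _) (proj₂ (proj₂ (sat 4 (λ _ → x))))
      }
    open Linear G using (reduced⇒independent; reduced⇒span)
    independently-spanned : IndependentlySpanned
    independently-spanned r xs with independently-spannedᶠ⁻ xs (sat (5 + r) xs)
    ... | j , zs , zs-independent , zs-spans = j , zs , reduced⇒independent zs-independent , λ t → reduced⇒span (zs-spans t)

  structure⇒⊨φ : IsAbelianGroupOfExponent M m → IndependentlySpanned → ∀ {ρ} → satΠ M 2 φ ρ
  structure⇒⊨φ G independently-spanned = ⊨φ
    where
    open IsAbelianGroupOfExponent G
    open Linear G using (independent⇒reduced; span⇒reduced)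
    ⊨φ : ∀ {ρ} → satΠ M 2 φ ρ
    ⊨φ 0 xs = 0 , (λ ()) , assoc _ _ _
    ⊨φ 1 xs = 0 , (λ ()) , comm _ _
    ⊨φ 2 xs = 0 , (λ ()) , identityˡ _
    ⊨φ 3 xs = 0 , (λ ()) , inverseˡ _
    ⊨φ 4 xs = 0 , (λ ()) , ≡.subst (_≈ ε) (≡.sym (⟦mulᵗ⟧ m (var zero) _)) (exponent _)
    ⊨φ (suc (suc (suc (suc (suc r))))) xs with independently-spanned r xs
    ... | j , zs , zs-independent , zs-spans =
      independently-spannedᶠ⁺ xs j zs (independent⇒reduced zs-independent) (λ t → span⇒reduced (zs-spans t))

module Preservation {M N : Str} (h : M ↪ N) where
  open _↪_ h
  private
    module M = Str M
    module N = Str N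
    module EN = IsEquivalence N.isEquiv

  Tracks : ∀ {k} → Vector N.Carrier k → Vector M.Carrier k → Set
  Tracks σ ρ = ∀ i → N._≈_ (σ i) (f (ρ i))

  tracks-++ : ∀ {k l} {τ : Vector N.Carrier k} {xs σ} {ρ : Vector M.Carrier l} →
              Tracks τ xs → Tracks σ ρ → Tracks (τ ++ σ) (xs ++ ρ)
  tracks-++ {k} τ≈ σ≈ i with splitAt k i
  ... | inj₁ a = τ≈ a
  ... | inj₂ b = σ≈ b

  ⟦⟧-tracks : ∀ {n} (t : Term n) {σ ρ} → Tracks σ ρ → N._≈_ (⟦ N ⟧t t σ) (f (⟦ M ⟧t t ρ))
  ⟦⟧-tracks (var i) σ≈ = σ≈ i
  ⟦⟧-tracks (s · t) σ≈ = EN.trans (N.∙-cong (⟦⟧-tracks s σ≈) (⟦⟧-tracks t σ≈)) (EN.sym (f-∙ _ _))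
  ⟦⟧-tracks (inv t) σ≈ = EN.trans (N.⁻¹-cong (⟦⟧-tracks t σ≈)) (EN.sym (f-⁻¹ _))
  ⟦⟧-tracks e       σ≈ = EN.sym f-ε

  mutual
    reflects-QF : ∀ {n} (φ : QF n) {σ ρ} → Tracks σ ρ → satQF N φ σ → satQF M φ ρ
    reflects-QF (s ≐ t)  σ≈ s≈t        = f-inj (EN.trans (EN.sym (⟦⟧-tracks s σ≈)) (EN.trans s≈t (⟦⟧-tracks t σ≈)))
    reflects-QF (¬ᶠ φ)   σ≈ ¬sat sat   = ¬sat (preserves-QF φ σ≈ sat)
    reflects-QF (φ ∧ᶠ ψ) σ≈ (sφ , sψ)  = reflects-QF φ σ≈ sφ , reflects-QF ψ σ≈ sψ
    reflects-QF (φ ∨ᶠ ψ) σ≈ (inj₁ sφ)  = inj₁ (reflects-QF φ σ≈ sφ)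
    reflects-QF (φ ∨ᶠ ψ) σ≈ (inj₂ sψ)  = inj₂ (reflects-QF ψ σ≈ sψ)

    preserves-QF : ∀ {n} (φ : QF n) {σ ρ} → Tracks σ ρ → satQF M φ ρ → satQF N φ σ
    preserves-QF (s ≐ t)  σ≈ s≈t       = EN.trans (⟦⟧-tracks s σ≈) (EN.trans (f-cong s≈t) (EN.sym (⟦⟧-tracks t σ≈)))
    preserves-QF (¬ᶠ φ)   σ≈ ¬sat sat  = ¬sat (reflects-QF φ σ≈ sat)
    preserves-QF (φ ∧ᶠ ψ) σ≈ (sφ , sψ) = preserves-QF φ σ≈ sφ , preserves-QF ψ σ≈ sψ
    preserves-QF (φ ∨ᶠ ψ) σ≈ (inj₁ sφ) = inj₁ (preserves-QF φ σ≈ sφ)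
    preserves-QF (φ ∨ᶠ ψ) σ≈ (inj₂ sψ) = inj₂ (preserves-QF ψ σ≈ sψ)

  reflects-Π₁ : ∀ {n} (φ : Πf 1 n) {σ ρ} → Tracks σ ρ → satΠ N 1 φ σ → satΠ M 1 φ ρ
  reflects-Π₁ φ σ≈ sat i xs = reflects-QF (proj₂ (φ i)) (tracks-++ (λ _ → EN.refl) σ≈) (sat i (λ j → f (xs j)))

module IsoPreservation {M N : Str} (iso : M ≅ N) where
  open Preservation (≅⇒↪ iso) public
  open _≅_ iso using (f; f-surj)
  private module EN = IsEquivalence (Str.isEquiv N)

  mutual
    reflects-Σ : ∀ a {n} (φ : Σf a n) {σ ρ} → Tracks σ ρ → satΣ N a φ σ → satΣ M a φ ρ
    reflects-Σ zero    φ σ≈ sat            = reflects-QF φ σ≈ sat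
    reflects-Σ (suc a) φ σ≈ (i , ys , sat) =
      i , xs , reflects-Π a (proj₂ (φ i)) (tracks-++ (λ j → EN.sym (proj₂ (f-surj (ys j)))) σ≈) sat
      where
      xs : Vector (Str.Carrier M) _
      xs j = proj₁ (f-surj (ys j))

    reflects-Π : ∀ a {n} (φ : Πf a n) {σ ρ} → Tracks σ ρ → satΠ N a φ σ → satΠ M a φ ρ
    reflects-Π zero    φ σ≈ sat      = reflects-QF φ σ≈ sat
    reflects-Π (suc a) φ σ≈ sat i xs =
      reflects-Σ a (proj₂ (φ i)) (tracks-++ (λ _ → EN.refl) σ≈) (sat i (λ j → f (xs j)))

-- No Σ₂ Scott sentence

module NoΣ₂ScottSentence {p : ℕ} (p-prime : Prime p) (n : ℕ) where
  open PrimePower p-prime n using (p^[1+n]≢0)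
  open ZmOmegaProperties (p ^ suc n)
  open Linear isAbelianGroupOfExponent
  open Exchange p-prime n isAbelianGroupOfExponent using (independent≤spanning)
  open SetoidReasoning setoid

  module Truncated (K : ℕ) where
    open Image (truncation K) public

    image-countable : Countable image
    image-countable = countable-by {image} decode decode-surjective

    -- image has the operations of ZmOmega, but Agda does not unfold its combinations to those of
    -- ZmOmega: the stuck terms mention the two structures, whose equalities differ.
    private
      •-image : ∀ c xs → Combination._•_ image c xs ≡ c • xs
      •-image zero    xs = ≡.refl
      •-image (suc c) xs = ≡.cong (addL xs) (•-image c xs)

      lc-image : ∀ {k} cs (xss : Vector (List ℕ) k) → Combination.lc image cs xss ≡ lc cs xss
      lc-image {zero}  cs xss = ≡.refl
      lc-image {suc k} cs xss = cong₂ addL (•-image (cs zero) (xss zero)) (lc-image (tail cs) (tail xss))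

    image≇ZmOmega : ¬ (image ≅ ZmOmega)
    image≇ZmOmega iso =
      1+n≰n (independent≤spanning (units-independent (suc K)) λ i → spanned-by-image (units (suc K) i))
      where
      open _≅_ iso
      spanned-by-image : ∀ y → Span (λ j → f (units K j)) y
      spanned-by-image y with f-surj y
      ... | y′ , fy′≈y = span cs (begin
        y                                     ≈⟨ fy′≈y ⟨
        f y′                                  ≈⟨ f-cong y′≈lc ⟩
        f (Combination.lc image cs (units K)) ≈⟨ ↪-lc (≅⇒↪ iso) cs (units K) ⟩
        lc cs (λ j → f (units K j))           ∎)
        where
        cs : Vector ℕ K
        cs = coordinates K y′
        y′≈lc : take K y′ ≈ take K (Combination.lc image cs (units K))
        y′≈lc = begin
          take K y′
            ≡⟨ ≡.trans (take-take K K y′) (≡.cong (λ k → take k y′) (⊓-idem K)) ⟨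
          take K (take K y′)                         ≈⟨ Endomorphism.h-cong (truncation K) (lc-coordinates K y′) ⟨
          take K (lc cs (units K))                   ≡⟨ ≡.cong (take K) (lc-image cs (units K)) ⟨
          take K (Combination.lc image cs (units K)) ∎

  no-Σ₂-Scott-sentence : ¬ (Σ (Σ-sentence 2) λ ψ → IsScottΣ ZmOmega 2 ψ)
  no-Σ₂-Scott-sentence (ψ , scott) with Equivalence.from (scott ZmOmega countable) ≅-refl
  ... | i , xs , ZmOmega⊨θ[xs] = image≇ZmOmega (Equivalence.to (scott image image-countable) (i , xs , image⊨θ[xs]))
    where
    open Truncated (Σlength xs)
    open Preservation image↪ using (tracks-++; reflects-Π₁)
    image⊨θ[xs] : ∀ {ρ} → satΠ image 1 (proj₂ (ψ i)) (xs ++ ρ)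
    image⊨θ[xs] = reflects-Π₁ (proj₂ (ψ i))
      (tracks-++ (λ t → reflexive (≡.sym (take-all _ (xs t) (length≤Σlength xs t)))) (λ ()))
      ZmOmega⊨θ[xs]

mainTheorem2 : (p n : ℕ) (pr : Prime p) → n ≥ 1 →
    ScottComplexityΠ (ZpnOmega p n pr) 2
mainTheorem2 p (suc n) p-prime@(prime _) (s≤s z≤n) = (φ , φ-is-Scott) , no-Σ₂-Scott-sentence
  where
  open PrimePower p-prime n using (p^[1+n]≢0)
  open ZmOmegaProperties (p ^ suc n) using (ZmOmega; isAbelianGroupOfExponent; independently-spanned)
  open ScottSentence (p ^ suc n) using (φ)
  open NoΣ₂ScottSentence p-prime n using (no-Σ₂-Scott-sentence)

  φ-is-Scott : IsScottΠ ZmOmega 2 φ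
  φ-is-Scott M countable = mk⇔
    (λ M⊨φ → let G , tuples-spanned = ⊨φ⇒structure M⊨φ in
               Classification.≅ZmOmega p-prime n G tuples-spanned countable)
    (λ M≅ZmOmega → IsoPreservation.reflects-Π M≅ZmOmega 2 φ {σ = λ ()} (λ ()) ZmOmega⊨φ)
    where
    open ScottSentenceSemantics M (p ^ suc n) using (⊨φ⇒structure)
    ZmOmega⊨φ : ∀ {ρ} → satΠ ZmOmega 2 φ ρ
    ZmOmega⊨φ = ScottSentenceSemantics.structure⇒⊨φ ZmOmega (p ^ suc n) isAbelianGroupOfExponent independently-spanned
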